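{- Let $M$ be a matroid on a finite set $E$ with a fixed linear order. The $h$-polynomial of the augmented nbc complex $\Delta^{\mathrm{nbc}}_M$ equals $T_M(1+q,0)$, where $T_M$ is the Tutte polynomial of $M$. Equivalently, the $h$-vector of $\Delta^{\mathrm{nbc}}_M$ equals the $f$-vector of the no broken circuit complex $\mathrm{NBC}(M)$.
   Context: Activities: for $S\subseteq E$, $e\in E\setminus S$ is externally active w.r.t. $S$ if there is a circuit $\gamma\subseteq S\cup\{e\}$ of $M$ with $e=\max\gamma$; set $\operatorname{EA}(S)$. An element $i\in S$ is internally active w.r.t. $S$ if it is externally active w.r.t. $E\setminus S$ in the dual matroid $M^\perp$; set $\operatorname{IA}(S)$. Every independent set $I$ is uniquely $B_I\setminus Y$ with $B_I$ a basis and $Y\subseteq\operatorname{IA}(B_I)$. $\mathrm{NBC}(M)$: the simplicial complex of subsets of $E$ containing no broken circuit (a circuit with its maximum element removed); these are exactly the independent sets $I$ with $\operatorname{EA}(I)=\emptyset$. $\Delta^{\mathrm{nbc}}_M$: vertices $\{y_e,z_e:e\in E\}$, facets $G(I)=\{y_e:e\in B_I\setminus I\}\cup\{z_e:e\in I\}$ for each nbc set $I$; it is pure of dimension $r-1$, $r$ the rank of $M$. $h$-polynomial: for a pure $(d-1)$-dimensional complex with $f_i$ faces of cardinality $i$ ($f_0=1$), $\sum_i f_i(q-1)^{d-i}=\sum_i h_iq^{d-i}$ defines the $h$-vector $(h_0,\dots,h_d)$ and $h$-polynomial $\sum_ih_iq^{d-i}$. -}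

module Defs where

open import Data.Bool using (Bool; true; false; _∧_; _∨_; not; T; if_then_else_)
open import Data.Nat as ℕ using (ℕ; zero; suc; _⊔_; _∸_; _≤_; _<_)
open import Data.Integer as ℤ using (ℤ; +_; -_)
open import Data.Fin using (Fin; toℕ)
open import Data.Fin.Subset using (Subset; _⊆_; _∈_; _∉_; _∪_; _∩_; _─_; _-_; ⁅_⁆; ∁; ∣_∣; ⊥; ⊤)
open import Data.Fin.Subset.Properties using (_⊆?_)
open import Data.List as List using (List; []; _∷_; allFin; filter; length)
open import Data.Vec as Vec using (Vec; []; _∷_; lookup)
open import Data.Product using (Σ; _×_; _,_; ∃)
open import Relation.Nullary.Decidable using (⌊_⌋)
import Data.Bool.ListAction as BLA
import Data.Nat.ListAction as NLA
open import Relation.Binary.PropositionalEquality using (_≡_)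

-- Finite sets: the ground set is E = Fin n, linearly ordered by the
-- usual order on Fin n.  Subsets are Data.Fin.Subset.Subset n.

allSubsets : (n : ℕ) → List (Subset n)
allSubsets zero    = [] ∷ []
allSubsets (suc n) = List.map (true ∷_) (allSubsets n) List.++ List.map (false ∷_) (allSubsets n)

module _ {n : ℕ} where

  _∈ᵇ_ : Fin n → Subset n → Bool
  e ∈ᵇ S = lookup S e

  _⊆ᵇ_ : Subset n → Subset n → Bool
  S ⊆ᵇ T′ = ⌊ S ⊆? T′ ⌋

  anyElem : (Fin n → Bool) → Bool
  anyElem p = BLA.any p (allFin n)

  allElem : (Fin n → Bool) → Bool
  allElem p = BLA.all p (allFin n)

  anySubset : (Subset n → Bool) → Bool
  anySubset p = BLA.any p (allSubsets n)

  countSubsets : (Subset n → Bool) → ℕ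
  countSubsets p = length (filter (λ S → T? (p S)) (allSubsets n))
    where
    open import Relation.Nullary using (Dec; yes; no)
    T? : (b : Bool) → Dec (T b)
    T? true  = yes _
    T? false = no (λ ())

  -- Notions defined relative to an arbitrary independence predicate
  -- (used both for M and for its dual M⊥).

  module WithIndep (indep : Subset n → Bool) where

    isBasis : Subset n → Bool
    isBasis B = indep B ∧ allElem (λ e → e ∈ᵇ B ∨ not (indep (B ∪ ⁅ e ⁆)))

    rank : Subset n → ℕ
    rank S = List.foldr (λ I m → if indep I ∧ (I ⊆ᵇ S) then ∣ I ∣ ⊔ m else m) 0 (allSubsets n)

    isCircuit : Subset n → Bool
    isCircuit C = not (indep C) ∧ allElem (λ e → not (e ∈ᵇ C) ∨ indep (C - e))

    isMaxOf : Fin n → Subset n → Bool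
    isMaxOf e γ = e ∈ᵇ γ ∧ allElem (λ f → not (f ∈ᵇ γ) ∨ ⌊ toℕ f ℕ.≤? toℕ e ⌋)

    extActive : Subset n → Fin n → Bool
    extActive S e = not (e ∈ᵇ S) ∧
      anySubset (λ γ → isCircuit γ ∧ (γ ⊆ᵇ (S ∪ ⁅ e ⁆)) ∧ isMaxOf e γ)

    containsBrokenCircuit : Subset n → Bool
    containsBrokenCircuit S =
      anySubset (λ γ → isCircuit γ ∧ anyElem (λ e → isMaxOf e γ ∧ ((γ - e) ⊆ᵇ S)))

record Matroid (n : ℕ) : Set where
  field
    indep        : Subset n → Bool
    indep-empty  : indep ⊥ ≡ true
    indep-subset : ∀ X Y → Y ⊆ X → indep X ≡ true → indep Y ≡ true
    indep-augment : ∀ X Y → indep X ≡ true → indep Y ≡ true → ∣ X ∣ < ∣ Y ∣ →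
                    ∃ λ e → e ∈ Y × e ∉ X × indep (X ∪ ⁅ e ⁆) ≡ true

-- Univariate integer polynomials as coefficient lists (lowest degree
-- first); equality is coefficientwise (trailing zeros irrelevant).

Poly : Set
Poly = List ℤ

coeff : Poly → ℕ → ℤ
coeff []       _       = + 0
coeff (a ∷ p)  zero    = a
coeff (a ∷ p)  (suc k) = coeff p k

_≈ₚ_ : Poly → Poly → Set
p ≈ₚ q = ∀ k → coeff p k ≡ coeff q k

infixl 6 _+ₚ_ _-ₚ_
infixl 7 _*ₚ_ _·ₚ_
infixr 8 _^ₚ_

_+ₚ_ : Poly → Poly → Poly
[]      +ₚ q       = q
(a ∷ p) +ₚ []      = a ∷ p
(a ∷ p) +ₚ (b ∷ q) = (a ℤ.+ b) ∷ (p +ₚ q)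

_·ₚ_ : ℤ → Poly → Poly
c ·ₚ p = List.map (c ℤ.*_) p

_*ₚ_ : Poly → Poly → Poly
[]      *ₚ q = []
(a ∷ p) *ₚ q = (a ·ₚ q) +ₚ (+ 0 ∷ (p *ₚ q))

negₚ : Poly → Poly
negₚ p = (- (+ 1)) ·ₚ p

_-ₚ_ : Poly → Poly → Poly
p -ₚ q = p +ₚ negₚ q

constₚ : ℤ → Poly
constₚ c = c ∷ []

oneₚ : Poly
oneₚ = constₚ (+ 1)

Xₚ : Poly
Xₚ = + 0 ∷ + 1 ∷ []

_^ₚ_ : Poly → ℕ → Poly
p ^ₚ zero  = oneₚ
p ^ₚ suc k = p *ₚ (p ^ₚ k)

sumₚ : ℕ → (ℕ → Poly) → Poly
sumₚ zero    f = f 0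
sumₚ (suc d) f = sumₚ d f +ₚ f (suc d)

module _ {n : ℕ} (M : Matroid n) where
  open Matroid M
  open WithIndep indep public using (isBasis; rank; isCircuit; isMaxOf)

  rk : ℕ
  rk = rank ⊤

  dualIndep : Subset n → Bool
  dualIndep X = anySubset (λ B → isBasis B ∧ ((X ∩ B) ⊆ᵇ ⊥))

  extActiveM : Subset n → Fin n → Bool
  extActiveM = WithIndep.extActive indep

  intActive : Subset n → Fin n → Bool
  intActive S i = (i ∈ᵇ S) ∧ WithIndep.extActive dualIndep (∁ S) i

  isNBC : Subset n → Bool
  isNBC S = not (WithIndep.containsBrokenCircuit indep S)

  -- B is the basis B_I of the independent set I, i.e. I = B ∖ Y with
  -- Y ⊆ IA(B)  (⇔ I ⊆ B and B ∖ I ⊆ IA(B))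
  isBasisOf : Subset n → Subset n → Bool
  isBasisOf I B = isBasis B ∧ (I ⊆ᵇ B) ∧ allElem (λ e → not (e ∈ᵇ (B ─ I)) ∨ intActive B e)

  -- Augmented nbc complex Δ^nbc_M.  A set of vertices
  -- {y_e : e ∈ A} ∪ {z_e : e ∈ Z} is encoded as the pair (A , Z).
  -- Facets: G(I) = (B_I ∖ I , I) for I nbc; faces: subsets of facets.
  isFacetΔ : Subset n → Subset n → Bool
  isFacetΔ A Z = isNBC Z ∧ anySubset (λ B → isBasisOf Z B ∧ (A ⊆ᵇ (B ─ Z)) ∧ ((B ─ Z) ⊆ᵇ A))

  isFaceΔ : Subset n → Subset n → Bool
  isFaceΔ A Z = anySubset (λ A′ → anySubset (λ Z′ →
                  isFacetΔ A′ Z′ ∧ (A ⊆ᵇ A′) ∧ (Z ⊆ᵇ Z′)))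

  -- f-vector of Δ^nbc_M: f_i = number of faces with exactly i vertices
  -- (counted directly, so f_0 = 1 whenever Δ has a facet)
  fΔ : ℕ → ℕ
  fΔ i = NLA.sum (List.map (λ A → countSubsets (λ Z →
           isFaceΔ A Z ∧ ⌊ ∣ A ∣ ℕ.+ ∣ Z ∣ ℕ.≟ i ⌋)) (allSubsets n))

  -- h-polynomial of Δ^nbc_M (pure of dimension r-1, so d = r):
  --   Σ_{i=0}^{d} f_i (q-1)^{d-i}  =  Σ_i h_i q^{d-i}
  hPolyΔ : Poly
  hPolyΔ = sumₚ rk (λ i → (+ fΔ i) ·ₚ ((Xₚ -ₚ oneₚ) ^ₚ (rk ∸ i)))

  hΔ : ℕ → ℤ
  hΔ i = coeff hPolyΔ (rk ∸ i)

  fNBC : ℕ → ℕ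
  fNBC i = countSubsets (λ S → isNBC S ∧ ⌊ ∣ S ∣ ℕ.≟ i ⌋)

  tutte : Poly → Poly → Poly
  tutte X Y = List.foldr _+ₚ_ [] (List.map (λ S →
                ((X -ₚ oneₚ) ^ₚ (rk ∸ rank S)) *ₚ ((Y -ₚ oneₚ) ^ₚ (∣ S ∣ ∸ rank S)))
                (allSubsets n))

-- The coefficient of q^k on either side counts the nbc sets of size r − k.
--
-- Tutte side: T_M(1 + q, 0) = ∑_S q^(r − r(S)) (−1)^(|S| − r(S)). Call e a candidate of S when e is
-- spanned by the elements of S below e; S contains a broken circuit iff it has a candidate. Toggling
-- the largest candidate of S keeps the rank and flips the sign, so only the nbc sets survive
-- (Whitney's broken circuit theorem).
--
-- Complex side: the faces of Δ^nbc_M are the pairs (A, Z) with Z nbc and A ⊆ B_Z ∖ Z, where B_Z ∖ Z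
-- consists of the x not spanned by Z together with the elements above x, and has r − |Z| elements.
-- So ∑_i f_i (q − 1)^(r − i) = ∑_Z ∑_{A ⊆ B_Z ∖ Z} (q − 1)^(|B_Z ∖ Z| − |A|) = ∑_Z q^(r − |Z|) by the
-- binomial theorem.

module Submission where

open import Defs
open import Data.Bool as Bool using (Bool; true; false; _∧_; _∨_; not; T; if_then_else_)
open import Data.Bool.Properties using (T-≡; ¬-not; ∧-zeroʳ; ⇔→≡)
import Data.Bool.ListAction as Bool
open import Data.Fin as Fin using (Fin; zero; suc; toℕ)
import Data.Fin.Properties as Finₚ
open import Data.Fin.Subset
  using (Subset; inside; outside; _∈_; _∉_; _⊆_; _∪_; _∩_; _─_; _-_; ⁅_⁆; ∁; ∣_∣; ⊥; Nonempty)
open import Data.Fin.Subset.Properties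
  using ( _∈?_; _⊆?_; nonempty?; Empty-unique; drop-there
        ; ⊆-refl; ⊆-trans; ⊆-antisym; ⊥⊆; ⊆⊤; ∉⊥
        ; x∈⁅x⁆; x∈⁅y⁆⇒x≡y; x∈p∪q⁻; p⊆p∪q; q⊆p∪q; x∈p∩q⁺; x∈p∩q⁻; p∩q⊆p; p∩q⊆q
        ; p─q⊆p; x∈p∧x∉q⇒x∈p─q; x∈p∧x≢y⇒x∈p-y; x∈p⇒x∉∁p; x∈∁p⇒x∉p; x∉p⇒x∈∁p
        ; ∪-assoc; ∪-comm; ∪-identityʳ; ∩-distribˡ-∪; p─⊥≡p
        ; ∣⊥∣≡0; p⊆q⇒∣p∣≤∣q∣; p⊂q⇒∣p∣<∣q∣; x∈p⇒∣p-x∣<∣p∣ )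
open import Data.Integer as ℤ using (ℤ; +_; -_; _+_; _*_; 0ℤ; 1ℤ; -1ℤ)
import Data.Integer.Properties as ℤₚ
open import Data.Integer.Tactic.RingSolver using (solve-∀)
open import Data.List as List using (List; []; _∷_; _++_; allFin; filter; length)
open import Data.List.Membership.Propositional using () renaming (_∈_ to _∈ₗ_)
open import Data.List.Membership.Propositional.Properties using (∈-allFin; ∈-map⁺; ∈-++⁺ˡ; ∈-++⁺ʳ)
import Data.List.Relation.Unary.All as All
open import Data.List.Relation.Unary.All.Properties using (all⁺; all⁻)
import Data.List.Relation.Unary.Any as Any
open import Data.List.Relation.Unary.Any.Properties using (any⁺; any⁻)
open import Data.Nat as ℕ using (ℕ; zero; suc; _≤_; _<_; _∸_; _⊔_; z≤n; s≤s; _<?_; _≤?_)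
import Data.Nat.ListAction as ℕ
import Data.Nat.Properties as ℕₚ
open import Data.Product using (∃-syntax; _×_; _,_; proj₁; proj₂)
open import Data.Sum using (_⊎_; inj₁; inj₂; [_,_]′)
open import Data.Vec using ([]; _∷_; here; there; lookup; tabulate)
import Data.Vec.Properties as Vecₚ
open import Function using (_∘_; id; _⇔_; mk⇔; Equivalence)
open import Relation.Binary.PropositionalEquality
open import Relation.Nullary using (¬_; Dec; yes; no; does; contradiction; ¬?; _×-dec_; _⊎-dec_; _→-dec_)
open import Relation.Nullary.Decidable using (⌊_⌋; isYes≗does; dec-true; dec-false; does-⇔; decidable-stable)
open import Relation.Unary using (Decidable)

open Equivalence using (to; from)

∧-true⁻ : ∀ {a b} → a ∧ b ≡ true → a ≡ true × b ≡ true
∧-true⁻ {true} {true} _ = refl , refl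

∧-true⁺ : ∀ {a b} → a ≡ true → b ≡ true → a ∧ b ≡ true
∧-true⁺ refl refl = refl

∧-cong-if : ∀ {a a′ b} → (b ≡ true → a ≡ a′) → a ∧ b ≡ a′ ∧ b
∧-cong-if {a} {a′} {false} _ = trans (∧-zeroʳ a) (sym (∧-zeroʳ a′))
∧-cong-if {b = true} h = cong (_∧ true) (h refl)

not-true⁻ : ∀ {a} → not a ≡ true → a ≡ false
not-true⁻ {false} _ = refl

⇒ᵇ-true⁻ : ∀ {a b} → not a ∨ b ≡ true → a ≡ true → b ≡ true
⇒ᵇ-true⁻ h refl = h

⇒ᵇ-true⁺ : ∀ {a b} → (a ≡ true → b ≡ true) → not a ∨ b ≡ true
⇒ᵇ-true⁺ {false} _ = refl
⇒ᵇ-true⁺ {true}  h = h refl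

does-true⁻ : ∀ {A : Set} (a? : Dec A) → does a? ≡ true → A
does-true⁻ (yes a) _ = a

⌊⌋-true⁻ : ∀ {A : Set} (a? : Dec A) → ⌊ a? ⌋ ≡ true → A
⌊⌋-true⁻ a? h = does-true⁻ a? (trans (sym (isYes≗does a?)) h)

⌊⌋-true⁺ : ∀ {A : Set} (a? : Dec A) → A → ⌊ a? ⌋ ≡ true
⌊⌋-true⁺ a? a = trans (isYes≗does a?) (dec-true a? a)

does≡ : ∀ {A : Set} (a? : Dec A) {b} → (A → b ≡ true) → (b ≡ true → A) → does a? ≡ b
does≡ (yes a) a⇒b _ = sym (a⇒b a)
does≡ (no ¬a) {false} _ _ = refl
does≡ (no ¬a) {true}  _ b⇒a = contradiction (b⇒a refl) ¬a

𝟙 : Bool → ℤ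
𝟙 true  = 1ℤ
𝟙 false = 0ℤ

𝟙-∧ : ∀ a b → 𝟙 (a ∧ b) ≡ 𝟙 a * 𝟙 b
𝟙-∧ true  b = sym (ℤₚ.*-identityˡ (𝟙 b))
𝟙-∧ false b = refl

𝟙*-cong : ∀ b {x y} → (b ≡ true → x ≡ y) → 𝟙 b * x ≡ 𝟙 b * y
𝟙*-cong false _   = refl
𝟙*-cong true  x≡y = cong (1ℤ *_) (x≡y refl)

*𝟙≡𝟙* : ∀ {x y} b → (b ≡ true → x ≡ y) → x * 𝟙 b ≡ 𝟙 b * y
*𝟙≡𝟙* {x} false _   = ℤₚ.*-zeroʳ x
*𝟙≡𝟙* {x} {y} true x≡y = trans (ℤₚ.*-identityʳ x) (trans (x≡y refl) (sym (ℤₚ.*-identityˡ y)))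

𝟙-split : ∀ {A B C : Set} (a? : Dec A) (b? : Dec B) (c? : Dec C) → (A ⇔ (B × ¬ C)) →
          𝟙 (does b?) ≡ 𝟙 (does a?) + 𝟙 (does (b? ×-dec c?))
𝟙-split (yes a) (yes b) (yes c) A⇔ = contradiction c (proj₂ (to A⇔ a))
𝟙-split (yes a) (yes b) (no ¬c) A⇔ = refl
𝟙-split (yes a) (no ¬b) c?      A⇔ = contradiction (proj₁ (to A⇔ a)) ¬b
𝟙-split (no ¬a) (yes b) (yes c) A⇔ = refl
𝟙-split (no ¬a) (yes b) (no ¬c) A⇔ = contradiction (from A⇔ (b , ¬c)) ¬a
𝟙-split (no ¬a) (no ¬b) c?      A⇔ = refl

δ : ℕ → ℕ → ℤ
δ a b = 𝟙 (does (a ℕ.≟ b))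

δ-refl : ∀ a → δ a a ≡ 1ℤ
δ-refl a = cong 𝟙 (dec-true (a ℕ.≟ a) refl)

δ-≢ : ∀ {a b} → a ≢ b → δ a b ≡ 0ℤ
δ-≢ {a} {b} a≢b = cong 𝟙 (dec-false (a ℕ.≟ b) a≢b)

δ-∸ : ∀ {m a b} → a ≤ m → b ≤ m → δ (m ∸ a) (m ∸ b) ≡ δ a b
δ-∸ {m} {a} {b} a≤m b≤m =
  cong 𝟙 (does-⇔ (mk⇔ (ℕₚ.∸-cancelˡ-≡ a≤m b≤m) (cong (m ∸_))) (m ∸ a ℕ.≟ m ∸ b) (a ℕ.≟ b))

module _ {n : ℕ} where

  ∈ᵇ⇒∈ : ∀ {x : Fin n} {p} → x ∈ᵇ p ≡ true → x ∈ p
  ∈ᵇ⇒∈ {x} {p} = Vecₚ.lookup⇒[]= x p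

  ∈⇒∈ᵇ : ∀ {x : Fin n} {p} → x ∈ p → x ∈ᵇ p ≡ true
  ∈⇒∈ᵇ = Vecₚ.[]=⇒lookup

  ∉⇒∈ᵇ : ∀ {x : Fin n} {p} → x ∉ p → x ∈ᵇ p ≡ false
  ∉⇒∈ᵇ x∉p = ¬-not (x∉p ∘ ∈ᵇ⇒∈)

  ∈ᵇ-false⇒∉ : ∀ {x : Fin n} {p} → x ∈ᵇ p ≡ false → x ∉ p
  ∈ᵇ-false⇒∉ x∉ᵇp x∈p = contradiction (trans (sym (∈⇒∈ᵇ x∈p)) x∉ᵇp) λ ()

  ⊆ᵇ⇒⊆ : ∀ {p q : Subset n} → p ⊆ᵇ q ≡ true → p ⊆ q
  ⊆ᵇ⇒⊆ {p} {q} = ⌊⌋-true⁻ (p ⊆? q)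

  ⊆⇒⊆ᵇ : ∀ {p q : Subset n} → p ⊆ q → p ⊆ᵇ q ≡ true
  ⊆⇒⊆ᵇ {p} {q} = ⌊⌋-true⁺ (p ⊆? q)

  ∈-tabulate⁻ : ∀ {f : Fin n → Bool} {x} → x ∈ tabulate f → f x ≡ true
  ∈-tabulate⁻ {f} {x} x∈ = trans (sym (Vecₚ.lookup∘tabulate f x)) (∈⇒∈ᵇ x∈)

  ∈-tabulate⁺ : ∀ {f : Fin n → Bool} {x} → f x ≡ true → x ∈ tabulate f
  ∈-tabulate⁺ {f} {x} fx = ∈ᵇ⇒∈ (trans (Vecₚ.lookup∘tabulate f x) fx)

∈-allSubsets : ∀ {n} (S : Subset n) → S ∈ₗ allSubsets n
∈-allSubsets []                    = Any.here refl
∈-allSubsets {suc n} (inside ∷ S)  = ∈-++⁺ˡ (∈-map⁺ (inside ∷_) (∈-allSubsets S))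
∈-allSubsets {suc n} (outside ∷ S) =
  ∈-++⁺ʳ (List.map (inside ∷_) (allSubsets n)) (∈-map⁺ (outside ∷_) (∈-allSubsets S))

module _ {A : Set} (p : A → Bool) where

  all-true⁻ : ∀ xs → Bool.all p xs ≡ true → ∀ {x} → x ∈ₗ xs → p x ≡ true
  all-true⁻ xs h x∈ = to T-≡ (All.lookup (all⁺ p xs (from T-≡ h)) x∈)

  all-true⁺ : ∀ xs → (∀ {x} → x ∈ₗ xs → p x ≡ true) → Bool.all p xs ≡ true
  all-true⁺ xs h = to T-≡ (all⁻ p (All.tabulate (from T-≡ ∘ h)))

  any-true⁻ : ∀ xs → Bool.any p xs ≡ true → ∃[ x ] p x ≡ true
  any-true⁻ xs h with Any.satisfied (any⁻ p xs (from T-≡ h))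
  ... | x , px = x , to T-≡ px

  any-true⁺ : ∀ {xs x} → x ∈ₗ xs → p x ≡ true → Bool.any p xs ≡ true
  any-true⁺ x∈ px = to T-≡ (any⁺ p (Any.map (λ { refl → from T-≡ px }) x∈))

module _ {n : ℕ} where

  allElem-true⁻ : ∀ {p : Fin n → Bool} → allElem p ≡ true → ∀ x → p x ≡ true
  allElem-true⁻ {p} h x = all-true⁻ p (allFin n) h (∈-allFin x)

  allElem-true⁺ : ∀ {p : Fin n → Bool} → (∀ x → p x ≡ true) → allElem p ≡ true
  allElem-true⁺ {p} h = all-true⁺ p (allFin n) (λ {x} _ → h x)

  allElem-⇒ᵇ⁻ : ∀ (p q : Fin n → Bool) → allElem (λ x → not (p x) ∨ q x) ≡ true →
                ∀ x → p x ≡ true → q x ≡ true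
  allElem-⇒ᵇ⁻ p q h x = ⇒ᵇ-true⁻ (allElem-true⁻ h x)

  allElem-⇒ᵇ⁺ : ∀ (p q : Fin n → Bool) → (∀ x → p x ≡ true → q x ≡ true) →
                allElem (λ x → not (p x) ∨ q x) ≡ true
  allElem-⇒ᵇ⁺ p q h = allElem-true⁺ (λ x → ⇒ᵇ-true⁺ (h x))

  anyElem-true⁻ : ∀ {p : Fin n → Bool} → anyElem p ≡ true → ∃[ x ] p x ≡ true
  anyElem-true⁻ {p} = any-true⁻ p (allFin n)

  anyElem-true⁺ : ∀ {p : Fin n → Bool} x → p x ≡ true → anyElem p ≡ true
  anyElem-true⁺ {p} x = any-true⁺ p (∈-allFin x)

  anySubset-true⁻ : ∀ {p : Subset n → Bool} → anySubset p ≡ true → ∃[ S ] p S ≡ true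
  anySubset-true⁻ {p} = any-true⁻ p (allSubsets n)

  anySubset-true⁺ : ∀ {p : Subset n → Bool} S → p S ≡ true → anySubset p ≡ true
  anySubset-true⁺ {p} S = any-true⁺ p (∈-allSubsets S)

x∈p─q⁻ : ∀ {n} (p q : Subset n) {x} → x ∈ p ─ q → x ∈ p × x ∉ q
x∈p─q⁻ (inside  ∷ p) (outside ∷ q) {zero}  here = here , λ ()
x∈p─q⁻ (outside ∷ p) (outside ∷ q) {zero}  ()
x∈p─q⁻ (outside ∷ p) (inside  ∷ q) {zero}  ()
x∈p─q⁻ (inside  ∷ p) (inside  ∷ q) {zero}  ()
x∈p─q⁻ (_       ∷ p) (_       ∷ q) {suc x} (there x∈) with x∈p─q⁻ p q x∈
... | x∈p , x∉q = there x∈p , x∉q ∘ drop-there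

module _ {n : ℕ} where

  x∈p-y⁻ : ∀ {p : Subset n} {x y} → x ∈ p - y → x ∈ p × x ≢ y
  x∈p-y⁻ {p} {y = y} x∈ with x∈p─q⁻ p ⁅ y ⁆ x∈
  ... | x∈p , x∉⁅y⁆ = x∈p , λ { refl → x∉⁅y⁆ (x∈⁅x⁆ y) }

  x∉p-x : ∀ (p : Subset n) x → x ∉ p - x
  x∉p-x p x x∈ = proj₂ (x∈p-y⁻ x∈) refl

  select : ∀ {P : Fin n → Set} → Decidable P → Subset n
  select P? = tabulate (λ x → ⌊ P? x ⌋)

  ∈-select⁻ : ∀ {P : Fin n → Set} (P? : Decidable P) {x} → x ∈ select P? → P x
  ∈-select⁻ P? {x} x∈ = ⌊⌋-true⁻ (P? x) (∈-tabulate⁻ x∈)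

  ∈-select⁺ : ∀ {P : Fin n → Set} (P? : Decidable P) {x} → P x → x ∈ select P?
  ∈-select⁺ P? {x} px = ∈-tabulate⁺ (⌊⌋-true⁺ (P? x) px)

  ∪-⊆ : ∀ {p q r : Subset n} → p ⊆ r → q ⊆ r → p ∪ q ⊆ r
  ∪-⊆ {p} {q} p⊆r q⊆r x∈ with x∈p∪q⁻ p q x∈
  ... | inj₁ x∈p = p⊆r x∈p
  ... | inj₂ x∈q = q⊆r x∈q

  ∪-monoˡ : ∀ {p q : Subset n} r → p ⊆ q → p ∪ r ⊆ q ∪ r
  ∪-monoˡ {q = q} r p⊆q = ∪-⊆ (p⊆p∪q r ∘ p⊆q) (q⊆p∪q q r)

  ∪-monoʳ : ∀ (p : Subset n) {q r} → q ⊆ r → p ∪ q ⊆ p ∪ r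
  ∪-monoʳ p {r = r} q⊆r = ∪-⊆ (p⊆p∪q r) (q⊆p∪q p r ∘ q⊆r)

  ⁅⁆-⊆ : ∀ {x : Fin n} {p} → x ∈ p → ⁅ x ⁆ ⊆ p
  ⁅⁆-⊆ {x} x∈p y∈ rewrite x∈⁅y⁆⇒x≡y x y∈ = x∈p

  x∈p∪⁅x⁆ : ∀ (p : Subset n) x → x ∈ p ∪ ⁅ x ⁆
  x∈p∪⁅x⁆ p x = q⊆p∪q p ⁅ x ⁆ (x∈⁅x⁆ x)

  x∈p∪⁅y⁆⁻ : ∀ (p : Subset n) {x y} → x ∈ p ∪ ⁅ y ⁆ → x ∈ p ⊎ x ≡ y
  x∈p∪⁅y⁆⁻ p {y = y} x∈ with x∈p∪q⁻ p ⁅ y ⁆ x∈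
  ... | inj₁ x∈p = inj₁ x∈p
  ... | inj₂ x∈⁅y⁆ = inj₂ (x∈⁅y⁆⇒x≡y y x∈⁅y⁆)

  p⊆p-x∪⁅x⁆ : ∀ (p : Subset n) x → p ⊆ (p - x) ∪ ⁅ x ⁆
  p⊆p-x∪⁅x⁆ p x {y} y∈p with y Fin.≟ x
  ... | yes refl = x∈p∪⁅x⁆ (p - x) y
  ... | no y≢x   = p⊆p∪q ⁅ x ⁆ (x∈p∧x≢y⇒x∈p-y y∈p y≢x)

x∉p⇒∣p∪⁅x⁆∣≡1+∣p∣ : ∀ {n} {p : Subset n} {x} → x ∉ p → ∣ p ∪ ⁅ x ⁆ ∣ ≡ suc ∣ p ∣
x∉p⇒∣p∪⁅x⁆∣≡1+∣p∣ {p = outside ∷ p} {zero}  _   = cong (suc ∘ ∣_∣) (∪-identityʳ p)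
x∉p⇒∣p∪⁅x⁆∣≡1+∣p∣ {p = inside  ∷ p} {zero}  x∉p = contradiction here x∉p
x∉p⇒∣p∪⁅x⁆∣≡1+∣p∣ {p = outside ∷ p} {suc x} x∉p = x∉p⇒∣p∪⁅x⁆∣≡1+∣p∣ (x∉p ∘ there)
x∉p⇒∣p∪⁅x⁆∣≡1+∣p∣ {p = inside  ∷ p} {suc x} x∉p = cong suc (x∉p⇒∣p∪⁅x⁆∣≡1+∣p∣ (x∉p ∘ there))

x∈p⇒1+∣p-x∣≡∣p∣ : ∀ {n} {p : Subset n} {x} → x ∈ p → suc ∣ p - x ∣ ≡ ∣ p ∣
x∈p⇒1+∣p-x∣≡∣p∣ {p = inside ∷ p} here = cong (suc ∘ ∣_∣) (p─⊥≡p p)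
x∈p⇒1+∣p-x∣≡∣p∣ {p = outside ∷ p} (there x∈p) = x∈p⇒1+∣p-x∣≡∣p∣ x∈p
x∈p⇒1+∣p-x∣≡∣p∣ {p = inside  ∷ p} (there x∈p) = cong suc (x∈p⇒1+∣p-x∣≡∣p∣ x∈p)

disjoint⇒∣p∪q∣≡∣p∣+∣q∣ : ∀ {n} (p q : Subset n) → (∀ {x} → x ∈ p → x ∉ q) →
                         ∣ p ∪ q ∣ ≡ ∣ p ∣ ℕ.+ ∣ q ∣
disjoint⇒∣p∪q∣≡∣p∣+∣q∣ []            []            _ = refl
disjoint⇒∣p∪q∣≡∣p∣+∣q∣ (inside  ∷ p) (inside  ∷ q) disj = contradiction here (disj here)
disjoint⇒∣p∪q∣≡∣p∣+∣q∣ (inside  ∷ p) (outside ∷ q) disj =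
  cong suc (disjoint⇒∣p∪q∣≡∣p∣+∣q∣ p q (λ x∈p x∈q → disj (there x∈p) (there x∈q)))
disjoint⇒∣p∪q∣≡∣p∣+∣q∣ (outside ∷ p) (inside  ∷ q) disj =
  trans (cong suc (disjoint⇒∣p∪q∣≡∣p∣+∣q∣ p q (λ x∈p x∈q → disj (there x∈p) (there x∈q))))
        (sym (ℕₚ.+-suc ∣ p ∣ ∣ q ∣))
disjoint⇒∣p∪q∣≡∣p∣+∣q∣ (outside ∷ p) (outside ∷ q) disj =
  disjoint⇒∣p∪q∣≡∣p∣+∣q∣ p q (λ x∈p x∈q → disj (there x∈p) (there x∈q))

p⊆q∧∣q∣≤∣p∣⇒p≡q : ∀ {n} {p q : Subset n} → p ⊆ q → ∣ q ∣ ≤ ∣ p ∣ → p ≡ q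
p⊆q∧∣q∣≤∣p∣⇒p≡q {p = p} p⊆q ∣q∣≤∣p∣ = ⊆-antisym p⊆q q⊆p
  where
  q⊆p : _ ⊆ p
  q⊆p {x} x∈q = decidable-stable (x ∈? p) λ x∉p →
    ℕₚ.<⇒≱ (p⊂q⇒∣p∣<∣q∣ (p⊆q , x , x∈q , x∉p)) ∣q∣≤∣p∣

+-interchange : ∀ a b c d → (a + b) + (c + d) ≡ (a + c) + (b + d)
+-interchange = solve-∀

-- Opaque so that ∑ f is rigid for unification; sums are manipulated only through the lemmas below.
opaque
  ∑ : ∀ {n} → (Subset n → ℤ) → ℤ
  ∑ {zero}  f = f []
  ∑ {suc n} f = ∑ (f ∘ (inside ∷_)) + ∑ (f ∘ (outside ∷_))

  ∑-[] : (f : Subset 0 → ℤ) → ∑ f ≡ f []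
  ∑-[] f = refl

  ∑-∷ : ∀ {n} (f : Subset (suc n) → ℤ) → ∑ f ≡ ∑[ S ] f (inside ∷ S) + ∑[ S ] f (outside ∷ S)
  ∑-∷ f = refl

  ∑-cong : ∀ {n} {f g : Subset n → ℤ} → (∀ S → f S ≡ g S) → ∑ f ≡ ∑ g
  ∑-cong {zero}  f≗g = f≗g []
  ∑-cong {suc n} f≗g = cong₂ _+_ (∑-cong (f≗g ∘ (inside ∷_))) (∑-cong (f≗g ∘ (outside ∷_)))

  ∑-zero : ∀ {n} → ∑ {n} (λ _ → 0ℤ) ≡ 0ℤ
  ∑-zero {zero}  = refl
  ∑-zero {suc n} = cong₂ _+_ (∑-zero {n}) (∑-zero {n})

  ∑-distrib-+ : ∀ {n} (f g : Subset n → ℤ) → ∑[ S ] (f S + g S) ≡ ∑ f + ∑ g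
  ∑-distrib-+ {zero}  f g = refl
  ∑-distrib-+ {suc n} f g = trans
    (cong₂ _+_ (∑-distrib-+ (f ∘ (inside ∷_)) (g ∘ (inside ∷_)))
               (∑-distrib-+ (f ∘ (outside ∷_)) (g ∘ (outside ∷_))))
    (+-interchange (∑ (f ∘ (inside ∷_))) (∑ (g ∘ (inside ∷_))) (∑ (f ∘ (outside ∷_))) (∑ (g ∘ (outside ∷_))))

  ∑-*ˡ : ∀ {n} c (f : Subset n → ℤ) → ∑[ S ] (c * f S) ≡ c * ∑ f
  ∑-*ˡ {zero}  c f = refl
  ∑-*ˡ {suc n} c f = trans (cong₂ _+_ (∑-*ˡ c (f ∘ (inside ∷_))) (∑-*ˡ c (f ∘ (outside ∷_))))
                           (sym (ℤₚ.*-distribˡ-+ c (∑ (f ∘ (inside ∷_))) (∑ (f ∘ (outside ∷_)))))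

  ∑-comm : ∀ {n} (f : Subset n → Subset n → ℤ) → ∑[ A ] (∑[ B ] f A B) ≡ ∑[ B ] (∑[ A ] f A B)
  ∑-comm {zero}  f = refl
  ∑-comm {suc n} f = begin
    ∑[ A ] (∑ (f₁₁ A) + ∑ (f₁₀ A)) + ∑[ A ] (∑ (f₀₁ A) + ∑ (f₀₀ A))
      ≡⟨ cong₂ _+_ (∑-distrib-+ (∑ ∘ f₁₁) (∑ ∘ f₁₀)) (∑-distrib-+ (∑ ∘ f₀₁) (∑ ∘ f₀₀)) ⟩
    (∑ (∑ ∘ f₁₁) + ∑ (∑ ∘ f₁₀)) + (∑ (∑ ∘ f₀₁) + ∑ (∑ ∘ f₀₀))
      ≡⟨ cong₂ _+_ (cong₂ _+_ (∑-comm f₁₁) (∑-comm f₁₀)) (cong₂ _+_ (∑-comm f₀₁) (∑-comm f₀₀)) ⟩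
    (∑ (∑ ∘ f₁₁ᵀ) + ∑ (∑ ∘ f₁₀ᵀ)) + (∑ (∑ ∘ f₀₁ᵀ) + ∑ (∑ ∘ f₀₀ᵀ))
      ≡⟨ +-interchange (∑ (∑ ∘ f₁₁ᵀ)) (∑ (∑ ∘ f₁₀ᵀ)) (∑ (∑ ∘ f₀₁ᵀ)) (∑ (∑ ∘ f₀₀ᵀ)) ⟩
    (∑ (∑ ∘ f₁₁ᵀ) + ∑ (∑ ∘ f₀₁ᵀ)) + (∑ (∑ ∘ f₁₀ᵀ) + ∑ (∑ ∘ f₀₀ᵀ))
      ≡⟨ sym (cong₂ _+_ (∑-distrib-+ (∑ ∘ f₁₁ᵀ) (∑ ∘ f₀₁ᵀ)) (∑-distrib-+ (∑ ∘ f₁₀ᵀ) (∑ ∘ f₀₀ᵀ))) ⟩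
    ∑[ B ] (∑ (f₁₁ᵀ B) + ∑ (f₀₁ᵀ B)) + ∑[ B ] (∑ (f₁₀ᵀ B) + ∑ (f₀₀ᵀ B)) ∎
    where
    open ≡-Reasoning
    f₁₁ f₁₀ f₀₁ f₀₀ f₁₁ᵀ f₁₀ᵀ f₀₁ᵀ f₀₀ᵀ : Subset n → Subset n → ℤ
    f₁₁ A B = f (inside ∷ A) (inside ∷ B)
    f₁₀ A B = f (inside ∷ A) (outside ∷ B)
    f₀₁ A B = f (outside ∷ A) (inside ∷ B)
    f₀₀ A B = f (outside ∷ A) (outside ∷ B)
    f₁₁ᵀ B A = f₁₁ A B
    f₁₀ᵀ B A = f₁₀ A B
    f₀₁ᵀ B A = f₀₁ A B
    f₀₀ᵀ B A = f₀₀ A B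

  ∑-pairing : ∀ {n} (e : Fin n) (g : Subset n → ℤ) →
              (∀ S → e ∉ S → g S + g (S ∪ ⁅ e ⁆) ≡ 0ℤ) → ∑ g ≡ 0ℤ
  ∑-pairing {suc n} zero g cancel = begin
    ∑ (g ∘ (inside ∷_)) + ∑ (g ∘ (outside ∷_)) ≡⟨ ℤₚ.+-comm (∑ (g ∘ (inside ∷_))) (∑ (g ∘ (outside ∷_))) ⟩
    ∑ (g ∘ (outside ∷_)) + ∑ (g ∘ (inside ∷_)) ≡⟨ sym (∑-distrib-+ (g ∘ (outside ∷_)) (g ∘ (inside ∷_))) ⟩
    ∑[ S ] (g (outside ∷ S) + g (inside ∷ S))  ≡⟨ ∑-cong pair ⟩
    ∑ {n} (λ _ → 0ℤ)                           ≡⟨ ∑-zero {n} ⟩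
    0ℤ                                         ∎
    where
    open ≡-Reasoning
    pair : ∀ S → g (outside ∷ S) + g (inside ∷ S) ≡ 0ℤ
    pair S = trans (cong (λ T → g (outside ∷ S) + g (inside ∷ T)) (sym (∪-identityʳ S)))
                   (cancel (outside ∷ S) λ ())
  ∑-pairing {suc n} (suc e) g cancel = cong₂ _+_
    (∑-pairing e (g ∘ (inside ∷_))  (λ S e∉S → cancel (inside ∷ S) (e∉S ∘ drop-there)))
    (∑-pairing e (g ∘ (outside ∷_)) (λ S e∉S → cancel (outside ∷ S) (e∉S ∘ drop-there)))

infix 9 ∑
syntax ∑ (λ S → e) = ∑[ S ] e

∑-*ʳ : ∀ {n} c (f : Subset n → ℤ) → ∑[ S ] (f S * c) ≡ ∑ f * c
∑-*ʳ c f = trans (∑-cong (λ S → ℤₚ.*-comm (f S) c)) (trans (∑-*ˡ c f) (ℤₚ.*-comm c (∑ f)))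


-- fΔ, fNBC and tutte are folds over the list allSubsets n; sumList connects them to ∑.

sumList : ∀ {A : Set} → List A → (A → ℤ) → ℤ
sumList xs f = List.foldr (λ x s → f x + s) 0ℤ xs

sumList-++ : ∀ {A : Set} (xs ys : List A) f → sumList (xs ++ ys) f ≡ sumList xs f + sumList ys f
sumList-++ []       ys f = sym (ℤₚ.+-identityˡ _)
sumList-++ (x ∷ xs) ys f = trans (cong (λ s → f x + s) (sumList-++ xs ys f)) (sym (ℤₚ.+-assoc (f x) _ _))

sumList-map : ∀ {A B : Set} (g : A → B) xs f → sumList (List.map g xs) f ≡ sumList xs (f ∘ g)
sumList-map g []       f = refl
sumList-map g (x ∷ xs) f = cong (λ s → f (g x) + s) (sumList-map g xs f)

opaque
  unfolding ∑

  sumList-allSubsets : ∀ {n} (f : Subset n → ℤ) → sumList (allSubsets n) f ≡ ∑ f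
  sumList-allSubsets {zero}  f = ℤₚ.+-identityʳ (f [])
  sumList-allSubsets {suc n} f = begin
    sumList (List.map (inside ∷_) (allSubsets n) ++ List.map (outside ∷_) (allSubsets n)) f
      ≡⟨ sumList-++ (List.map (inside ∷_) (allSubsets n)) _ f ⟩
    sumList (List.map (inside ∷_) (allSubsets n)) f + sumList (List.map (outside ∷_) (allSubsets n)) f
      ≡⟨ cong₂ _+_ (sumList-map (inside ∷_) (allSubsets n) f) (sumList-map (outside ∷_) (allSubsets n) f) ⟩
    sumList (allSubsets n) (f ∘ (inside ∷_)) + sumList (allSubsets n) (f ∘ (outside ∷_))
      ≡⟨ cong₂ _+_ (sumList-allSubsets (f ∘ (inside ∷_))) (sumList-allSubsets (f ∘ (outside ∷_))) ⟩
    ∑ (f ∘ (inside ∷_)) + ∑ (f ∘ (outside ∷_)) ∎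
    where open ≡-Reasoning

+-length-filter : ∀ {A : Set} (p : A → Bool) (P? : Decidable (T ∘ p)) xs →
                  + length (filter P? xs) ≡ sumList xs (𝟙 ∘ p)
+-length-filter p P? [] = refl
+-length-filter p P? (x ∷ xs) with p x | P? x
... | true  | yes _ = trans (ℤₚ.pos-+ 1 _) (cong (λ s → 1ℤ + s) (+-length-filter p P? xs))
... | true  | no ¬t = contradiction _ ¬t
... | false | no _  = trans (+-length-filter p P? xs) (sym (ℤₚ.+-identityˡ _))

countSubsets≡∑ : ∀ {n} (p : Subset n → Bool) → + countSubsets p ≡ ∑[ S ] 𝟙 (p S)
countSubsets≡∑ {n} p = trans (+-length-filter p _ (allSubsets n)) (sumList-allSubsets (𝟙 ∘ p))

+-sum-map : ∀ {A : Set} (g : A → ℕ) xs → + ℕ.sum (List.map g xs) ≡ sumList xs (+_ ∘ g)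
+-sum-map g []       = refl
+-sum-map g (x ∷ xs) = trans (ℤₚ.pos-+ (g x) _) (cong (λ s → + g x + s) (+-sum-map g xs))

coeff-+ₚ : ∀ p q k → coeff (p +ₚ q) k ≡ coeff p k + coeff q k
coeff-+ₚ []      q       k       = sym (ℤₚ.+-identityˡ _)
coeff-+ₚ (a ∷ p) []      k       = sym (ℤₚ.+-identityʳ _)
coeff-+ₚ (a ∷ p) (b ∷ q) zero    = refl
coeff-+ₚ (a ∷ p) (b ∷ q) (suc k) = coeff-+ₚ p q k

coeff-·ₚ : ∀ c p k → coeff (c ·ₚ p) k ≡ c * coeff p k
coeff-·ₚ c []      k       = sym (ℤₚ.*-zeroʳ c)
coeff-·ₚ c (a ∷ p) zero    = refl
coeff-·ₚ c (a ∷ p) (suc k) = coeff-·ₚ c p k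

coeff-foldr-+ₚ : ∀ {A : Set} (g : A → Poly) xs k →
                 coeff (List.foldr _+ₚ_ [] (List.map g xs)) k ≡ sumList xs (λ x → coeff (g x) k)
coeff-foldr-+ₚ g []       k = refl
coeff-foldr-+ₚ g (x ∷ xs) k = trans (coeff-+ₚ (g x) _ k) (cong (λ s → coeff (g x) k + s) (coeff-foldr-+ₚ g xs k))

coeff-*ₚ-zero : ∀ a p q → coeff ((a ∷ p) *ₚ q) zero ≡ a * coeff q zero
coeff-*ₚ-zero a p q = trans (coeff-+ₚ (a ·ₚ q) _ zero) (trans (ℤₚ.+-identityʳ _) (coeff-·ₚ a q zero))

coeff-*ₚ-suc : ∀ a p q k → coeff ((a ∷ p) *ₚ q) (suc k) ≡ a * coeff q (suc k) + coeff (p *ₚ q) k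
coeff-*ₚ-suc a p q k = trans (coeff-+ₚ (a ·ₚ q) _ (suc k)) (cong (_+ coeff (p *ₚ q) k) (coeff-·ₚ a q (suc k)))

coeff-constₚ-*ₚ : ∀ c q k → coeff (constₚ c *ₚ q) k ≡ c * coeff q k
coeff-constₚ-*ₚ c q zero    = coeff-*ₚ-zero c [] q
coeff-constₚ-*ₚ c q (suc k) = trans (coeff-*ₚ-suc c [] q k) (ℤₚ.+-identityʳ _)

coeff-*ₚ-constant : ∀ p q → (∀ j → coeff q (suc j) ≡ 0ℤ) → ∀ k → coeff (p *ₚ q) k ≡ coeff p k * coeff q zero
coeff-*ₚ-constant []      q q-const k       = refl
coeff-*ₚ-constant (a ∷ p) q q-const zero    = coeff-*ₚ-zero a p q
coeff-*ₚ-constant (a ∷ p) q q-const (suc k) = begin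
  coeff ((a ∷ p) *ₚ q) (suc k)           ≡⟨ coeff-*ₚ-suc a p q k ⟩
  a * coeff q (suc k) + coeff (p *ₚ q) k ≡⟨ cong₂ _+_ (cong (a *_) (q-const k)) (coeff-*ₚ-constant p q q-const k) ⟩
  a * 0ℤ + coeff p k * coeff q zero      ≡⟨ cong (_+ coeff p k * coeff q zero) (ℤₚ.*-zeroʳ a) ⟩
  0ℤ + coeff p k * coeff q zero          ≡⟨ ℤₚ.+-identityˡ _ ⟩
  coeff p k * coeff q zero               ∎
  where open ≡-Reasoning

coeff-constₚ^ₚ-zero : ∀ c b → coeff (constₚ c ^ₚ b) zero ≡ c ℤ.^ b
coeff-constₚ^ₚ-zero c zero    = refl
coeff-constₚ^ₚ-zero c (suc b) = trans (coeff-constₚ-*ₚ c (constₚ c ^ₚ b) zero) (cong (c *_) (coeff-constₚ^ₚ-zero c b))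

coeff-constₚ^ₚ-suc : ∀ c b k → coeff (constₚ c ^ₚ b) (suc k) ≡ 0ℤ
coeff-constₚ^ₚ-suc c zero    k = refl
coeff-constₚ^ₚ-suc c (suc b) k =
  trans (coeff-constₚ-*ₚ c (constₚ c ^ₚ b) (suc k)) (trans (cong (c *_) (coeff-constₚ^ₚ-suc c b k)) (ℤₚ.*-zeroʳ c))

coeff-Xₚ*ₚ-zero : ∀ p → coeff (Xₚ *ₚ p) zero ≡ 0ℤ
coeff-Xₚ*ₚ-zero p = coeff-*ₚ-zero 0ℤ (1ℤ ∷ []) p

coeff-Xₚ*ₚ-suc : ∀ p k → coeff (Xₚ *ₚ p) (suc k) ≡ coeff p k
coeff-Xₚ*ₚ-suc p k = begin
  coeff (Xₚ *ₚ p) (suc k)                      ≡⟨ coeff-*ₚ-suc 0ℤ (1ℤ ∷ []) p k ⟩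
  0ℤ * coeff p (suc k) + coeff (constₚ 1ℤ *ₚ p) k ≡⟨ ℤₚ.+-identityˡ _ ⟩
  coeff (constₚ 1ℤ *ₚ p) k                     ≡⟨ coeff-constₚ-*ₚ 1ℤ p k ⟩
  1ℤ * coeff p k                               ≡⟨ ℤₚ.*-identityˡ _ ⟩
  coeff p k                                    ∎
  where open ≡-Reasoning

coeff-Xₚ^ₚ : ∀ d k → coeff (Xₚ ^ₚ d) k ≡ δ d k
coeff-Xₚ^ₚ zero    zero    = refl
coeff-Xₚ^ₚ zero    (suc k) = refl
coeff-Xₚ^ₚ (suc d) zero    = coeff-Xₚ*ₚ-zero (Xₚ ^ₚ d)
coeff-Xₚ^ₚ (suc d) (suc k) = trans (coeff-Xₚ*ₚ-suc (Xₚ ^ₚ d) k) (coeff-Xₚ^ₚ d k)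

[X-1]^ : ℕ → Poly
[X-1]^ d = (Xₚ -ₚ oneₚ) ^ₚ d

coeff-[X-1]^-zero : ∀ k → coeff ([X-1]^ 0) k ≡ δ 0 k
coeff-[X-1]^-zero zero    = refl
coeff-[X-1]^-zero (suc k) = refl

coeff-[X-1]^-pascal : ∀ d k → coeff ([X-1]^ d) k + coeff ([X-1]^ (suc d)) k ≡ coeff (Xₚ *ₚ [X-1]^ d) k
coeff-[X-1]^-pascal d zero = begin
  c zero + coeff ([X-1]^ (suc d)) zero ≡⟨ cong (λ y → c zero + y) (coeff-*ₚ-zero -1ℤ (1ℤ ∷ []) ([X-1]^ d)) ⟩
  c zero + -1ℤ * c zero                ≡⟨ cancel (c zero) ⟩
  0ℤ                                   ≡⟨ coeff-Xₚ*ₚ-zero ([X-1]^ d) ⟨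
  coeff (Xₚ *ₚ [X-1]^ d) zero          ∎
  where
  open ≡-Reasoning
  c = coeff ([X-1]^ d)
  cancel : ∀ a → a + -1ℤ * a ≡ 0ℤ
  cancel = solve-∀
coeff-[X-1]^-pascal d (suc k) = begin
  c (suc k) + coeff ([X-1]^ (suc d)) (suc k)
    ≡⟨ cong (λ y → c (suc k) + y) (coeff-*ₚ-suc -1ℤ (1ℤ ∷ []) ([X-1]^ d) k) ⟩
  c (suc k) + (-1ℤ * c (suc k) + coeff (constₚ 1ℤ *ₚ [X-1]^ d) k)
    ≡⟨ cong (λ x → c (suc k) + (-1ℤ * c (suc k) + x)) (coeff-constₚ-*ₚ 1ℤ ([X-1]^ d) k) ⟩
  c (suc k) + (-1ℤ * c (suc k) + 1ℤ * c k)
    ≡⟨ cancel (c (suc k)) (c k) ⟩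
  c k
    ≡⟨ coeff-Xₚ*ₚ-suc ([X-1]^ d) k ⟨
  coeff (Xₚ *ₚ [X-1]^ d) (suc k) ∎
  where
  open ≡-Reasoning
  c = coeff ([X-1]^ d)
  cancel : ∀ a b → a + (-1ℤ * a + 1ℤ * b) ≡ b
  cancel = solve-∀

-- The binomial theorem ∑_{A ⊆ D} (X - 1)^|D∖A| = X^|D|, coefficientwise.
∑-⊆-[X-1]^ : ∀ {n} (D : Subset n) k →
             ∑[ A ] (𝟙 (does (A ⊆? D)) * coeff ([X-1]^ (∣ D ∣ ∸ ∣ A ∣)) k) ≡ δ ∣ D ∣ k
∑-⊆-[X-1]^ [] k = trans (∑-[] _) (trans (ℤₚ.*-identityˡ _) (coeff-[X-1]^-zero k))
∑-⊆-[X-1]^ (outside ∷ D) k = begin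
  ∑ term                                               ≡⟨ ∑-∷ term ⟩
  ∑[ A ] term (inside ∷ A) + ∑[ A ] term (outside ∷ A) ≡⟨ cong₂ _+_ ∑-zero (∑-⊆-[X-1]^ D k) ⟩
  0ℤ + δ (∣ D ∣) k                                     ≡⟨ ℤₚ.+-identityˡ _ ⟩
  δ (∣ D ∣) k                                          ∎
  where
  open ≡-Reasoning
  term : Subset _ → ℤ
  term A = 𝟙 (does (A ⊆? outside ∷ D)) * coeff ([X-1]^ (∣ outside ∷ D ∣ ∸ ∣ A ∣)) k
∑-⊆-[X-1]^ (inside ∷ D) k = begin
  ∑ term                                                             ≡⟨ ∑-∷ term ⟩
  ∑[ A ] term (inside ∷ A) + ∑[ A ] term (outside ∷ A)               ≡⟨ ∑-distrib-+ _ _ ⟨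
  ∑[ A ] (term (inside ∷ A) + term (outside ∷ A))                   ≡⟨ ∑-cong pascal ⟩
  ∑[ A ] (𝟙 (does (A ⊆? D)) * coeff (Xₚ *ₚ [X-1]^ (∣ D ∣ ∸ ∣ A ∣)) k) ≡⟨ shift k ⟩
  δ (suc ∣ D ∣) k                                                    ∎
  where
  open ≡-Reasoning
  term : Subset _ → ℤ
  term A = 𝟙 (does (A ⊆? inside ∷ D)) * coeff ([X-1]^ (∣ inside ∷ D ∣ ∸ ∣ A ∣)) k
  pascal : ∀ A → term (inside ∷ A) + term (outside ∷ A) ≡ 𝟙 (does (A ⊆? D)) * coeff (Xₚ *ₚ [X-1]^ (∣ D ∣ ∸ ∣ A ∣)) k
  pascal A with A ⊆? D
  ... | no _ = refl
  ... | yes A⊆D rewrite ℕₚ.+-∸-assoc 1 (p⊆q⇒∣p∣≤∣q∣ A⊆D) =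
    trans (sym (ℤₚ.*-distribˡ-+ 1ℤ (coeff ([X-1]^ (∣ D ∣ ∸ ∣ A ∣)) k) (coeff ([X-1]^ (suc (∣ D ∣ ∸ ∣ A ∣))) k)))
          (cong (1ℤ *_) (coeff-[X-1]^-pascal (∣ D ∣ ∸ ∣ A ∣) k))
  shift : ∀ k → ∑[ A ] (𝟙 (does (A ⊆? D)) * coeff (Xₚ *ₚ [X-1]^ (∣ D ∣ ∸ ∣ A ∣)) k) ≡ δ (suc ∣ D ∣) k
  shift zero    = trans (∑-cong λ A → cong (𝟙 (does (A ⊆? D)) *_) (coeff-Xₚ*ₚ-zero ([X-1]^ (∣ D ∣ ∸ ∣ A ∣))))
                        (trans (∑-cong λ A → ℤₚ.*-zeroʳ (𝟙 (does (A ⊆? D)))) ∑-zero)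
  shift (suc k) = trans (∑-cong λ A → cong (𝟙 (does (A ⊆? D)) *_) (coeff-Xₚ*ₚ-suc ([X-1]^ (∣ D ∣ ∸ ∣ A ∣)) k))
                        (∑-⊆-[X-1]^ D k)

coeff-Xₚ^ₚ-*ₚ-constₚ^ₚ : ∀ a c b k → coeff ((Xₚ ^ₚ a) *ₚ (constₚ c ^ₚ b)) k ≡ δ a k * c ℤ.^ b
coeff-Xₚ^ₚ-*ₚ-constₚ^ₚ a c b k = trans (coeff-*ₚ-constant (Xₚ ^ₚ a) _ (coeff-constₚ^ₚ-suc c b) k)
                                       (cong₂ _*_ (coeff-Xₚ^ₚ a k) (coeff-constₚ^ₚ-zero c b))

∑≤ : ℕ → (ℕ → ℤ) → ℤ
∑≤ zero    g = g 0
∑≤ (suc d) g = ∑≤ d g + g (suc d)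

coeff-sumₚ : ∀ d f k → coeff (sumₚ d f) k ≡ ∑≤ d (λ i → coeff (f i) k)
coeff-sumₚ zero    f k = refl
coeff-sumₚ (suc d) f k =
  trans (coeff-+ₚ (sumₚ d f) (f (suc d)) k) (cong (_+ coeff (f (suc d)) k) (coeff-sumₚ d f k))

∑≤-cong : ∀ d {f g : ℕ → ℤ} → (∀ i → f i ≡ g i) → ∑≤ d f ≡ ∑≤ d g
∑≤-cong zero    f≗g = f≗g 0
∑≤-cong (suc d) f≗g = cong₂ _+_ (∑≤-cong d f≗g) (f≗g (suc d))

∑≤-∑ : ∀ {n} d (f : ℕ → Subset n → ℤ) → ∑≤ d (λ i → ∑ (f i)) ≡ ∑[ S ] ∑≤ d (λ i → f i S)
∑≤-∑ zero    f = refl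
∑≤-∑ (suc d) f = trans (cong (_+ ∑ (f (suc d))) (∑≤-∑ d f)) (sym (∑-distrib-+ _ _))

∑≤-*ˡ : ∀ d c (g : ℕ → ℤ) → ∑≤ d (λ i → c * g i) ≡ c * ∑≤ d g
∑≤-*ˡ zero    c g = refl
∑≤-*ˡ (suc d) c g = trans (cong (_+ c * g (suc d)) (∑≤-*ˡ d c g)) (sym (ℤₚ.*-distribˡ-+ c _ _))

∑≤-δ-out : ∀ d m (g : ℕ → ℤ) → d < m → ∑≤ d (λ i → δ m i * g i) ≡ 0ℤ
∑≤-δ-out zero    m g d<m = cong (_* g 0) (δ-≢ (ℕₚ.>⇒≢ d<m))
∑≤-δ-out (suc d) m g d<m = begin
  ∑≤ d (λ i → δ m i * g i) + δ m (suc d) * g (suc d) ≡⟨ cong₂ _+_ (∑≤-δ-out d m g (ℕₚ.<-trans (ℕₚ.n<1+n d) d<m))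
                                                               (cong (_* g (suc d)) (δ-≢ (ℕₚ.>⇒≢ d<m))) ⟩
  0ℤ + 0ℤ * g (suc d)                                 ≡⟨⟩
  0ℤ                                                  ∎
  where open ≡-Reasoning

∑≤-δ : ∀ d m (g : ℕ → ℤ) → m ≤ d → ∑≤ d (λ i → δ m i * g i) ≡ g m
∑≤-δ zero    zero g z≤n = trans (cong (_* g 0) (δ-refl 0)) (ℤₚ.*-identityˡ (g 0))
∑≤-δ (suc d) m    g m≤1+d with m ℕ.≟ suc d
... | yes refl = begin
  ∑≤ d (λ i → δ m i * g i) + δ m m * g m ≡⟨ cong₂ _+_ (∑≤-δ-out d m g ℕₚ.≤-refl) (cong (_* g m) (δ-refl m)) ⟩
  0ℤ + 1ℤ * g m                          ≡⟨ ℤₚ.+-identityˡ _ ⟩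
  1ℤ * g m                               ≡⟨ ℤₚ.*-identityˡ (g m) ⟩
  g m                                    ∎
  where open ≡-Reasoning
... | no m≢1+d = begin
  ∑≤ d (λ i → δ m i * g i) + δ m (suc d) * g (suc d) ≡⟨ cong₂ _+_ (∑≤-δ d m g (ℕₚ.≤-pred (ℕₚ.≤∧≢⇒< m≤1+d m≢1+d)))
                                                                (cong (_* g (suc d)) (δ-≢ m≢1+d)) ⟩
  g m + 0ℤ                                            ≡⟨ ℤₚ.+-identityʳ (g m) ⟩
  g m                                                 ∎
  where open ≡-Reasoning

-- rank M S unfolds to maxOver (λ I → indep I ∧ (I ⊆ᵇ S)) ∣_∣ (allSubsets n).
module _ {A : Set} (c : A → Bool) (g : A → ℕ) where

  maxOver : List A → ℕ
  maxOver = List.foldr (λ x m → if c x then g x ⊔ m else m) 0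

  ≤-maxOver : ∀ {xs x} → x ∈ₗ xs → c x ≡ true → g x ≤ maxOver xs
  ≤-maxOver {y ∷ xs} (Any.here refl) cx rewrite cx = ℕₚ.m≤m⊔n (g y) (maxOver xs)
  ≤-maxOver {y ∷ xs} (Any.there x∈) cx with c y
  ... | true  = ℕₚ.≤-trans (≤-maxOver x∈ cx) (ℕₚ.m≤n⊔m (g y) (maxOver xs))
  ... | false = ≤-maxOver x∈ cx

  maxOver-attained : ∀ xs → maxOver xs ≡ 0 ⊎ ∃[ x ] (c x ≡ true × g x ≡ maxOver xs)
  maxOver-attained []       = inj₁ refl
  maxOver-attained (y ∷ xs) with c y in cy
  ... | false = maxOver-attained xs
  ... | true with ℕₚ.⊔-sel (g y) (maxOver xs) | maxOver-attained xs
  ...   | inj₁ g⊔m≡g | _                      = inj₂ (y , cy , sym g⊔m≡g)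
  ...   | inj₂ g⊔m≡m | inj₁ m≡0               = inj₁ (trans g⊔m≡m m≡0)
  ...   | inj₂ g⊔m≡m | inj₂ (x , cx , gx≡m)   = inj₂ (x , cx , trans gx≡m (sym g⊔m≡m))

module Rank {n : ℕ} (M : Matroid n) where
  open Matroid M

  r : ℕ
  r = rk M

  indep-⊆ : ∀ {X Y} → Y ⊆ X → indep X ≡ true → indep Y ≡ true
  indep-⊆ {X} {Y} = indep-subset X Y

  MaxIndepIn : Subset n → Subset n → Set
  MaxIndepIn J T = indep J ≡ true × J ⊆ T × ∣ J ∣ ≡ rank M T

  indep⇒∣∣≤rank : ∀ {I S} → indep I ≡ true → I ⊆ S → ∣ I ∣ ≤ rank M S
  indep⇒∣∣≤rank {I} {S} indI I⊆S =
    ≤-maxOver (λ I → indep I ∧ (I ⊆ᵇ S)) ∣_∣ (∈-allSubsets I) (∧-true⁺ indI (⊆⇒⊆ᵇ I⊆S))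

  rank-witness : ∀ T → ∃[ J ] MaxIndepIn J T
  rank-witness T with maxOver-attained (λ I → indep I ∧ (I ⊆ᵇ T)) ∣_∣ (allSubsets n)
  ... | inj₁ rank≡0 = ⊥ , indep-empty , ⊥⊆ , trans (∣⊥∣≡0 n) (sym rank≡0)
  ... | inj₂ (J , cJ , ∣J∣≡rank) with ∧-true⁻ cJ
  ...   | indJ , J⊆ᵇT = J , indJ , ⊆ᵇ⇒⊆ J⊆ᵇT , ∣J∣≡rank

  rank≤∣∣ : ∀ S → rank M S ≤ ∣ S ∣
  rank≤∣∣ S with rank-witness S
  ... | J , _ , J⊆S , ∣J∣≡rank = subst (_≤ ∣ S ∣) ∣J∣≡rank (p⊆q⇒∣p∣≤∣q∣ J⊆S)

  rank-mono : ∀ {S T} → S ⊆ T → rank M S ≤ rank M T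
  rank-mono {S} {T} S⊆T with rank-witness S
  ... | J , indJ , J⊆S , ∣J∣≡rank = subst (_≤ rank M T) ∣J∣≡rank (indep⇒∣∣≤rank indJ (⊆-trans J⊆S S⊆T))

  rank-indep : ∀ {S} → indep S ≡ true → rank M S ≡ ∣ S ∣
  rank-indep {S} indS = ℕₚ.≤-antisym (rank≤∣∣ S) (indep⇒∣∣≤rank indS ⊆-refl)

  ∣∣≤rank⇒indep : ∀ {S} → ∣ S ∣ ≤ rank M S → indep S ≡ true
  ∣∣≤rank⇒indep {S} ∣S∣≤rank with rank-witness S
  ... | J , indJ , J⊆S , ∣J∣≡rank =
    subst (λ X → indep X ≡ true) (p⊆q∧∣q∣≤∣p∣⇒p≡q J⊆S (subst (∣ S ∣ ≤_) (sym ∣J∣≡rank) ∣S∣≤rank)) indJ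

  augment : ∀ {I S} → indep I ≡ true → I ⊆ S → ∣ I ∣ < rank M S →
            ∃[ x ] (x ∈ S × x ∉ I × indep (I ∪ ⁅ x ⁆) ≡ true)
  augment {I} {S} indI I⊆S ∣I∣<rank with rank-witness S
  ... | J , indJ , J⊆S , ∣J∣≡rank with indep-augment I J indI indJ (subst (∣ I ∣ <_) (sym ∣J∣≡rank) ∣I∣<rank)
  ...   | x , x∈J , x∉I , indIx = x , J⊆S x∈J , x∉I , indIx

  extend : ∀ {I T} → indep I ≡ true → I ⊆ T → ∃[ J ] (I ⊆ J × MaxIndepIn J T)
  extend {I} {T} indI I⊆T = go (rank M T ∸ ∣ I ∣) ℕₚ.≤-refl indI I⊆T
    where
    go : ∀ {I} fuel → rank M T ∸ ∣ I ∣ ≤ fuel → indep I ≡ true → I ⊆ T → ∃[ J ] (I ⊆ J × MaxIndepIn J T)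
    go {I} fuel gap≤fuel indI I⊆T with ∣ I ∣ ℕ.<? rank M T
    ... | no ∣I∣≮rank = I , ⊆-refl , indI , I⊆T , ℕₚ.≤-antisym (indep⇒∣∣≤rank indI I⊆T) (ℕₚ.≮⇒≥ ∣I∣≮rank)
    ... | yes ∣I∣<rank with augment indI I⊆T ∣I∣<rank
    ...   | x , x∈T , x∉I , indIx with fuel
    ...     | zero = contradiction gap≤fuel (ℕₚ.<⇒≱ (ℕₚ.m<n⇒0<n∸m ∣I∣<rank))
    ...     | suc fuel′ with go fuel′ gap′≤fuel′ indIx (∪-⊆ I⊆T (⁅⁆-⊆ x∈T))
      where
      gap′≤fuel′ : rank M T ∸ ∣ I ∪ ⁅ x ⁆ ∣ ≤ fuel′
      gap′≤fuel′ rewrite x∉p⇒∣p∪⁅x⁆∣≡1+∣p∣ x∉I =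
        ℕₚ.≤-pred (ℕₚ.<-≤-trans (ℕₚ.∸-monoʳ-< (ℕₚ.n<1+n ∣ I ∣) ∣I∣<rank) gap≤fuel)
    ...       | J , I∪x⊆J , maxJ = J , I∪x⊆J ∘ p⊆p∪q ⁅ x ⁆ , maxJ

  rank-∪⁅⁆≤ : ∀ S x → rank M (S ∪ ⁅ x ⁆) ≤ suc (rank M S)
  rank-∪⁅⁆≤ S x with rank-witness (S ∪ ⁅ x ⁆)
  ... | J , indJ , J⊆S∪x , ∣J∣≡rank = subst (_≤ suc (rank M S)) ∣J∣≡rank (begin
    ∣ J ∣               ≤⟨ p⊆q⇒∣p∣≤∣q∣ (p⊆p-x∪⁅x⁆ J x) ⟩
    ∣ (J - x) ∪ ⁅ x ⁆ ∣ ≡⟨ x∉p⇒∣p∪⁅x⁆∣≡1+∣p∣ (x∉p-x J x) ⟩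
    suc ∣ J - x ∣       ≤⟨ s≤s (indep⇒∣∣≤rank (indep-⊆ (p─q⊆p J ⁅ x ⁆) indJ) J-x⊆S) ⟩
    suc (rank M S)      ∎)
    where
    open ℕₚ.≤-Reasoning
    J-x⊆S : J - x ⊆ S
    J-x⊆S y∈ with x∈p-y⁻ y∈
    ... | y∈J , y≢x with x∈p∪⁅y⁆⁻ S (J⊆S∪x y∈J)
    ...   | inj₁ y∈S = y∈S
    ...   | inj₂ y≡x = contradiction y≡x y≢x

  _∈cl_ : Fin n → Subset n → Set
  x ∈cl S = rank M (S ∪ ⁅ x ⁆) ≡ rank M S

  _∈cl?_ : ∀ x S → Dec (x ∈cl S)
  x ∈cl? S = rank M (S ∪ ⁅ x ⁆) ℕ.≟ rank M S

  ∈⇒∈cl : ∀ {x S} → x ∈ S → x ∈cl S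
  ∈⇒∈cl {x} {S} x∈S = ℕₚ.≤-antisym (rank-mono (∪-⊆ ⊆-refl (⁅⁆-⊆ x∈S))) (rank-mono (p⊆p∪q ⁅ x ⁆))

  ∉cl⇒rank-suc : ∀ {x S} → ¬ x ∈cl S → rank M (S ∪ ⁅ x ⁆) ≡ suc (rank M S)
  ∉cl⇒rank-suc {x} {S} x∉clS =
    ℕₚ.≤-antisym (rank-∪⁅⁆≤ S x) (ℕₚ.≤∧≢⇒< (rank-mono (p⊆p∪q ⁅ x ⁆)) (x∉clS ∘ sym))

  ∣∣<rank-∪⁅⁆ : ∀ {J U y} → y ∉ J → indep (J ∪ ⁅ y ⁆) ≡ true → J ∪ ⁅ y ⁆ ⊆ U → ∣ J ∣ < rank M U
  ∣∣<rank-∪⁅⁆ {J} {U} {y} y∉J indJy J∪y⊆U = begin-strict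
    ∣ J ∣         <⟨ ℕₚ.n<1+n ∣ J ∣ ⟩
    suc ∣ J ∣     ≡⟨ x∉p⇒∣p∪⁅x⁆∣≡1+∣p∣ y∉J ⟨
    ∣ J ∪ ⁅ y ⁆ ∣ ≤⟨ indep⇒∣∣≤rank indJy J∪y⊆U ⟩
    rank M U      ∎
    where open ℕₚ.≤-Reasoning

  maxIndep-∈cl⁻ : ∀ {J T x} → MaxIndepIn J T → x ∈cl T → x ∉ J → indep (J ∪ ⁅ x ⁆) ≡ false
  maxIndep-∈cl⁻ {J} {T} {x} (_ , J⊆T , ∣J∣≡rank) x∈clT x∉J = ¬-not λ indJx →
    ℕₚ.<-irrefl (trans ∣J∣≡rank (sym x∈clT)) (∣∣<rank-∪⁅⁆ x∉J indJx (∪-monoˡ ⁅ x ⁆ J⊆T))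

  maxIndep-∈cl⁺ : ∀ {J T x} → MaxIndepIn J T → indep (J ∪ ⁅ x ⁆) ≡ false → x ∈cl T
  maxIndep-∈cl⁺ {J} {T} {x} (indJ , J⊆T , ∣J∣≡rank) depJx = decidable-stable (x ∈cl? T) λ x∉clT →
    no-extension (augment indJ (⊆-trans J⊆T (p⊆p∪q ⁅ x ⁆))
      (subst₂ _<_ (sym ∣J∣≡rank) (sym (∉cl⇒rank-suc x∉clT)) (ℕₚ.n<1+n (rank M T))))
    where
    no-extension : ¬ (∃[ y ] (y ∈ T ∪ ⁅ x ⁆ × y ∉ J × indep (J ∪ ⁅ y ⁆) ≡ true))
    no-extension (y , y∈T∪x , y∉J , indJy) with x∈p∪⁅y⁆⁻ T y∈T∪x
    ... | inj₂ refl = contradiction (trans (sym indJy) depJx) λ ()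
    ... | inj₁ y∈T  = ℕₚ.<-irrefl ∣J∣≡rank (∣∣<rank-∪⁅⁆ y∉J indJy (∪-⊆ J⊆T (⁅⁆-⊆ y∈T)))

  ∈cl-mono : ∀ {S T x} → S ⊆ T → x ∈cl S → x ∈cl T
  ∈cl-mono {S} {T} {x} S⊆T x∈clS with rank-witness S
  ... | J , maxJ@(indJ , J⊆S , _) with extend indJ (⊆-trans J⊆S S⊆T)
  ...   | J′ , J⊆J′ , maxJ′@(_ , J′⊆T , _) with x ∈? J′
  ...     | yes x∈J′ = ∈⇒∈cl (J′⊆T x∈J′)
  ...     | no  x∉J′ = maxIndep-∈cl⁺ maxJ′ (¬-not λ indJ′x →
    contradiction (indep-⊆ (∪-monoˡ ⁅ x ⁆ J⊆J′) indJ′x) (λ indJx →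
      contradiction (trans (sym indJx) (maxIndep-∈cl⁻ maxJ x∈clS (x∉J′ ∘ J⊆J′))) λ ()))

  isBasis⁻ : ∀ {B} → isBasis M B ≡ true → indep B ≡ true × ∣ B ∣ ≡ r
  isBasis⁻ {B} isBasisB with ∧-true⁻ isBasisB
  ... | indB , maximal = indB , ℕₚ.≤-antisym (indep⇒∣∣≤rank indB ⊆⊤) (ℕₚ.≮⇒≥ not-smaller)
    where
    not-smaller : ¬ ∣ B ∣ < r
    not-smaller ∣B∣<r with augment indB ⊆⊤ ∣B∣<r
    ... | x , _ , x∉B , indBx = contradiction
      (trans (sym (allElem-true⁻ maximal x)) (cong₂ _∨_ (∉⇒∈ᵇ x∉B) (cong not indBx))) λ ()

  isBasis⁺ : ∀ {B} → indep B ≡ true → ∣ B ∣ ≡ r → isBasis M B ≡ true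
  isBasis⁺ {B} indB ∣B∣≡r = ∧-true⁺ indB (allElem-true⁺ maximal)
    where
    maximal : ∀ x → (x ∈ᵇ B ∨ not (indep (B ∪ ⁅ x ⁆))) ≡ true
    maximal x with x ∈ᵇ B in x∈ᵇB | indep (B ∪ ⁅ x ⁆) in indBx
    ... | true  | _     = refl
    ... | false | false = refl
    ... | false | true  = contradiction (∣∣<rank-∪⁅⁆ (∈ᵇ-false⇒∉ {p = B} x∈ᵇB) indBx ⊆⊤) (ℕₚ.<-irrefl ∣B∣≡r)

  ∣exchange∣ : ∀ {B : Subset n} {x f} → x ∈ B → f ∉ B → ∣ (B - x) ∪ ⁅ f ⁆ ∣ ≡ ∣ B ∣
  ∣exchange∣ {B} {x} x∈B f∉B =
    trans (x∉p⇒∣p∪⁅x⁆∣≡1+∣p∣ (f∉B ∘ proj₁ ∘ x∈p-y⁻ {p = B} {y = x})) (x∈p⇒1+∣p-x∣≡∣p∣ x∈B)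

  ∈cl-absorb : ∀ {x T} → x ∈cl T → ∀ y → (y ∈cl (T ∪ ⁅ x ⁆) ⇔ y ∈cl T)
  ∈cl-absorb {x} {T} x∈clT y =
    mk⇔ (λ h → trans (sym swap) (trans h x∈clT)) (λ h → trans swap (trans h (sym x∈clT)))
    where
    swap : rank M ((T ∪ ⁅ x ⁆) ∪ ⁅ y ⁆) ≡ rank M (T ∪ ⁅ y ⁆)
    swap = begin
      rank M ((T ∪ ⁅ x ⁆) ∪ ⁅ y ⁆) ≡⟨ cong (rank M) (∪-assoc T ⁅ x ⁆ ⁅ y ⁆) ⟩
      rank M (T ∪ (⁅ x ⁆ ∪ ⁅ y ⁆)) ≡⟨ cong (λ X → rank M (T ∪ X)) (∪-comm ⁅ x ⁆ ⁅ y ⁆) ⟩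
      rank M (T ∪ (⁅ y ⁆ ∪ ⁅ x ⁆)) ≡⟨ cong (rank M) (∪-assoc T ⁅ y ⁆ ⁅ x ⁆) ⟨
      rank M ((T ∪ ⁅ y ⁆) ∪ ⁅ x ⁆) ≡⟨ ∈cl-mono (p⊆p∪q ⁅ y ⁆) x∈clT ⟩
      rank M (T ∪ ⁅ y ⁆)           ∎
      where open ≡-Reasoning

IsMaxOf : ∀ {n} → Fin n → Subset n → Set
IsMaxOf e γ = e ∈ γ × (∀ {f} → f ∈ γ → toℕ f ≤ toℕ e)

∃-max : ∀ {n} (γ : Subset n) → Nonempty γ → ∃[ e ] IsMaxOf e γ
∃-max {suc n} (s ∷ γ) ne with nonempty? γ
... | yes ne′ with ∃-max γ ne′
...   | e , e∈γ , max = suc e , there e∈γ , bounded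
  where
  bounded : ∀ {f} → f ∈ s ∷ γ → toℕ f ≤ suc (toℕ e)
  bounded {zero}  _           = z≤n
  bounded {suc f} (there f∈γ) = s≤s (max f∈γ)
∃-max (inside  ∷ γ) ne                      | no ¬ne′ = zero , here , bounded
  where
  bounded : ∀ {f} → f ∈ inside ∷ γ → toℕ f ≤ 0
  bounded here        = z≤n
  bounded (there f∈γ) = contradiction (_ , f∈γ) ¬ne′
∃-max (outside ∷ γ) (suc x , there x∈γ) | no ¬ne′ = contradiction (x , x∈γ) ¬ne′

module _ {n : ℕ} (indep : Subset n → Bool) where
  private module W = WithIndep indep

  IsCircuit : Subset n → Set
  IsCircuit γ = indep γ ≡ false × (∀ {e} → e ∈ γ → indep (γ - e) ≡ true)

  isCircuit⁻ : ∀ {γ} → W.isCircuit γ ≡ true → IsCircuit γ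
  isCircuit⁻ {γ} h with ∧-true⁻ h
  ... | dep , minimal =
    not-true⁻ dep , λ {e} e∈γ → allElem-⇒ᵇ⁻ (_∈ᵇ γ) (λ e → indep (γ - e)) minimal e (∈⇒∈ᵇ e∈γ)

  isCircuit⁺ : ∀ {γ} → IsCircuit γ → W.isCircuit γ ≡ true
  isCircuit⁺ {γ} (dep , minimal) =
    ∧-true⁺ (cong not dep) (allElem-⇒ᵇ⁺ (_∈ᵇ γ) (λ e → indep (γ - e)) (λ e → minimal ∘ ∈ᵇ⇒∈))

  isMaxOf⁻ : ∀ {e γ} → W.isMaxOf e γ ≡ true → IsMaxOf e γ
  isMaxOf⁻ {e} {γ} h with ∧-true⁻ h
  ... | e∈γ , max = ∈ᵇ⇒∈ e∈γ , λ {f} f∈γ →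
    ⌊⌋-true⁻ (toℕ f ≤? toℕ e) (allElem-⇒ᵇ⁻ (_∈ᵇ γ) (λ f → ⌊ toℕ f ≤? toℕ e ⌋) max f (∈⇒∈ᵇ f∈γ))

  isMaxOf⁺ : ∀ {e γ} → IsMaxOf e γ → W.isMaxOf e γ ≡ true
  isMaxOf⁺ {e} {γ} (e∈γ , max) =
    ∧-true⁺ (∈⇒∈ᵇ e∈γ) (allElem-⇒ᵇ⁺ (_∈ᵇ γ) (λ f → ⌊ toℕ f ≤? toℕ e ⌋)
                                    (λ f f∈γ → ⌊⌋-true⁺ (toℕ f ≤? toℕ e) (max (∈ᵇ⇒∈ f∈γ))))

  containsBrokenCircuit⁻ : ∀ {S} → W.containsBrokenCircuit S ≡ true →
                           ∃[ γ ] ∃[ e ] (IsCircuit γ × IsMaxOf e γ × γ - e ⊆ S)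
  containsBrokenCircuit⁻ h with anySubset-true⁻ h
  ... | γ , hγ with ∧-true⁻ hγ
  ...   | circuit , hasMax with anyElem-true⁻ hasMax
  ...     | e , he with ∧-true⁻ he
  ...       | max , γ-e⊆S = γ , e , isCircuit⁻ circuit , isMaxOf⁻ max , ⊆ᵇ⇒⊆ γ-e⊆S

  containsBrokenCircuit⁺ : ∀ {S γ e} → IsCircuit γ → IsMaxOf e γ → γ - e ⊆ S →
                           W.containsBrokenCircuit S ≡ true
  containsBrokenCircuit⁺ {γ = γ} {e} circuit max γ-e⊆S =
    anySubset-true⁺ γ (∧-true⁺ (isCircuit⁺ circuit) (anyElem-true⁺ e (∧-true⁺ (isMaxOf⁺ max) (⊆⇒⊆ᵇ γ-e⊆S))))

  extActive⁻ : ∀ {S e} → W.extActive S e ≡ true →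
               e ∉ S × ∃[ γ ] (IsCircuit γ × γ ⊆ S ∪ ⁅ e ⁆ × IsMaxOf e γ)
  extActive⁻ {S} h with ∧-true⁻ h
  ... | e∉S , active with anySubset-true⁻ active
  ...   | γ , hγ with ∧-true⁻ hγ
  ...     | circuit , rest with ∧-true⁻ rest
  ...       | γ⊆S∪e , max =
    ∈ᵇ-false⇒∉ {p = S} (not-true⁻ e∉S) , γ , isCircuit⁻ circuit , ⊆ᵇ⇒⊆ γ⊆S∪e , isMaxOf⁻ max

  extActive⁺ : ∀ {S e γ} → e ∉ S → IsCircuit γ → γ ⊆ S ∪ ⁅ e ⁆ → IsMaxOf e γ →
               W.extActive S e ≡ true
  extActive⁺ {S} {e} {γ} e∉S circuit γ⊆S∪e max = ∧-true⁺ (cong not (∉⇒∈ᵇ e∉S))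
    (anySubset-true⁺ γ (∧-true⁺ (isCircuit⁺ circuit) (∧-true⁺ (⊆⇒⊆ᵇ γ⊆S∪e) (isMaxOf⁺ max))))

module BrokenCircuits {n : ℕ} (M : Matroid n) where
  open Matroid M
  open Rank M

  dependent⇒∃-circuit : ∀ {D} → indep D ≡ false → ∃[ γ ] (IsCircuit indep γ × γ ⊆ D)
  dependent⇒∃-circuit {D} = go (suc ∣ D ∣) (ℕₚ.n<1+n ∣ D ∣)
    where
    go : ∀ {D} fuel → ∣ D ∣ < fuel → indep D ≡ false → ∃[ γ ] (IsCircuit indep γ × γ ⊆ D)
    go {D} (suc fuel) ∣D∣<1+fuel depD with Finₚ.any? (λ e → e ∈? D ×-dec indep (D - e) Bool.≟ false)
    ... | no ¬removable = D , (depD , λ e∈D → ¬-not λ dep → ¬removable (_ , e∈D , dep)) , ⊆-refl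
    ... | yes (e , e∈D , depD-e)
      with go fuel (ℕₚ.<-≤-trans (x∈p⇒∣p-x∣<∣p∣ e∈D) (ℕₚ.≤-pred ∣D∣<1+fuel)) depD-e
    ...   | γ , circuit , γ⊆D-e = γ , circuit , p─q⊆p D ⁅ e ⁆ ∘ γ⊆D-e

  circuit-nonempty : ∀ {γ} → IsCircuit indep γ → Nonempty γ
  circuit-nonempty {γ} (depγ , _) = decidable-stable (nonempty? γ) λ empty →
    contradiction (trans (sym (subst (λ X → indep X ≡ true) (sym (Empty-unique empty)) indep-empty)) depγ) λ ()

  nbc⇒indep : ∀ {S} → isNBC M S ≡ true → indep S ≡ true
  nbc⇒indep {S} nbc = ¬-not λ depS →
    let γ , circuit , γ⊆S = dependent⇒∃-circuit depS
        e , max = ∃-max γ (circuit-nonempty circuit)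
    in  contradiction
          (trans (sym nbc) (cong not (containsBrokenCircuit⁺ indep circuit max (γ⊆S ∘ p─q⊆p γ ⁅ e ⁆)))) λ ()

  nbc-⊆ : ∀ {Z Z′} → Z ⊆ Z′ → isNBC M Z′ ≡ true → isNBC M Z ≡ true
  nbc-⊆ {Z} {Z′} Z⊆Z′ nbcZ′ = cong not (¬-not λ brokenZ →
    let γ , e , circuit , max , γ-e⊆Z = containsBrokenCircuit⁻ indep brokenZ
    in  contradiction (trans (sym nbcZ′) (cong not (containsBrokenCircuit⁺ indep circuit max (Z⊆Z′ ∘ γ-e⊆Z)))) λ ())

module Whitney {n : ℕ} (M : Matroid n) where
  open Matroid M
  open Rank M
  open BrokenCircuits M

  below : Subset n → Fin n → Subset n
  below S e = S ∩ select (λ f → toℕ f <? toℕ e)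

  ∈-below⁻ : ∀ {S e f} → f ∈ below S e → f ∈ S × toℕ f < toℕ e
  ∈-below⁻ {S} {e} f∈ with x∈p∩q⁻ S _ f∈
  ... | f∈S , f<e = f∈S , ∈-select⁻ (λ f → toℕ f <? toℕ e) f<e

  ∈-below⁺ : ∀ {S e f} → f ∈ S → toℕ f < toℕ e → f ∈ below S e
  ∈-below⁺ {S} {e} f∈S f<e = x∈p∩q⁺ (f∈S , ∈-select⁺ (λ f → toℕ f <? toℕ e) f<e)

  e∉below : ∀ S e → e ∉ below S e
  e∉below S e e∈ = ℕₚ.<-irrefl refl (proj₂ (∈-below⁻ e∈))

  IsCandidate : Subset n → Fin n → Set
  IsCandidate S e = e ∈cl below S e

  circuit-max⇒candidate : ∀ {S γ e} → IsCircuit indep γ → IsMaxOf e γ → γ - e ⊆ S → IsCandidate S e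
  circuit-max⇒candidate {S} {γ} {e} (depγ , minimal) (e∈γ , max) γ-e⊆S with extend (minimal e∈γ) γ-e⊆below
    where
    γ-e⊆below : γ - e ⊆ below S e
    γ-e⊆below f∈ with x∈p-y⁻ f∈
    ... | f∈γ , f≢e = ∈-below⁺ (γ-e⊆S f∈) (ℕₚ.≤∧≢⇒< (max f∈γ) (f≢e ∘ Finₚ.toℕ-injective))
  ... | J , γ-e⊆J , maxJ = maxIndep-∈cl⁺ maxJ (¬-not λ indJe →
    contradiction (trans (sym (indep-⊆ (⊆-trans (p⊆p-x∪⁅x⁆ γ e) (∪-monoˡ ⁅ e ⁆ γ-e⊆J)) indJe)) depγ) λ ())

  brokenCircuit⇒candidate : ∀ {S} → WithIndep.containsBrokenCircuit indep S ≡ true → ∃[ e ] IsCandidate S e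
  brokenCircuit⇒candidate broken =
    let _ , e , circuit , max , γ-e⊆S = containsBrokenCircuit⁻ indep broken
    in  e , circuit-max⇒candidate circuit max γ-e⊆S

  candidate⇒brokenCircuit : ∀ {S e} → IsCandidate S e → WithIndep.containsBrokenCircuit indep S ≡ true
  candidate⇒brokenCircuit {S} {e} cand with rank-witness (below S e)
  ... | J , maxJ@(indJ , J⊆below , _) with dependent⇒∃-circuit (maxIndep-∈cl⁻ maxJ cand (e∉below S e ∘ J⊆below))
  ...   | γ , circuit@(depγ , _) , γ⊆J∪e = containsBrokenCircuit⁺ indep circuit (e∈γ , max) γ-e⊆S
    where
    e∈γ : e ∈ γ
    e∈γ = decidable-stable (e ∈? γ) λ e∉γ →
      contradiction (trans (sym (indep-⊆ (γ⊆J e∉γ) indJ)) depγ) λ ()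
      where
      γ⊆J : e ∉ γ → γ ⊆ J
      γ⊆J e∉γ f∈γ with x∈p∪⁅y⁆⁻ J (γ⊆J∪e f∈γ)
      ... | inj₁ f∈J = f∈J
      ... | inj₂ refl = contradiction f∈γ e∉γ
    max : ∀ {f} → f ∈ γ → toℕ f ≤ toℕ e
    max f∈γ with x∈p∪⁅y⁆⁻ J (γ⊆J∪e f∈γ)
    ... | inj₁ f∈J  = ℕₚ.<⇒≤ (proj₂ (∈-below⁻ (J⊆below f∈J)))
    ... | inj₂ refl = ℕₚ.≤-refl
    γ-e⊆S : γ - e ⊆ S
    γ-e⊆S f∈ with x∈p-y⁻ f∈
    ... | f∈γ , f≢e with x∈p∪⁅y⁆⁻ J (γ⊆J∪e f∈γ)
    ...   | inj₁ f∈J  = proj₁ (∈-below⁻ (J⊆below f∈J))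
    ...   | inj₂ f≡e = contradiction f≡e f≢e

  nbc⇒¬candidate : ∀ {S} → isNBC M S ≡ true → ∀ e → ¬ IsCandidate S e
  nbc⇒¬candidate nbc e cand = contradiction (trans (sym nbc) (cong not (candidate⇒brokenCircuit cand))) λ ()

  ¬candidate⇒nbc : ∀ {S} → (∀ e → ¬ IsCandidate S e) → isNBC M S ≡ true
  ¬candidate⇒nbc none = cong not (¬-not λ broken → let e , cand = brokenCircuit⇒candidate broken in none e cand)

  below-∪-self : ∀ S e → below (S ∪ ⁅ e ⁆) e ≡ below S e
  below-∪-self S e =
    ⊆-antisym ⊆below (λ f∈ → let f∈S , f<e = ∈-below⁻ f∈ in ∈-below⁺ (p⊆p∪q ⁅ e ⁆ f∈S) f<e)
    where
    ⊆below : below (S ∪ ⁅ e ⁆) e ⊆ below S e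
    ⊆below f∈ with ∈-below⁻ f∈
    ... | f∈S∪e , f<e with x∈p∪⁅y⁆⁻ S f∈S∪e
    ...   | inj₁ f∈S = ∈-below⁺ f∈S f<e
    ...   | inj₂ refl = contradiction f<e (ℕₚ.<-irrefl refl)

  below-∪-smaller : ∀ S {e f} → toℕ e < toℕ f → below (S ∪ ⁅ e ⁆) f ≡ below S f ∪ ⁅ e ⁆
  below-∪-smaller S {e} {f} e<f = ⊆-antisym ⊆∪ ∪⊆
    where
    ⊆∪ : below (S ∪ ⁅ e ⁆) f ⊆ below S f ∪ ⁅ e ⁆
    ⊆∪ g∈ with ∈-below⁻ g∈
    ... | g∈S∪e , g<f with x∈p∪⁅y⁆⁻ S g∈S∪e
    ...   | inj₁ g∈S = p⊆p∪q ⁅ e ⁆ (∈-below⁺ g∈S g<f)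
    ...   | inj₂ refl = x∈p∪⁅x⁆ (below S f) e
    ∪⊆ : below S f ∪ ⁅ e ⁆ ⊆ below (S ∪ ⁅ e ⁆) f
    ∪⊆ g∈ with x∈p∪⁅y⁆⁻ (below S f) g∈
    ... | inj₁ g∈below = let g∈S , g<f = ∈-below⁻ g∈below in ∈-below⁺ (p⊆p∪q ⁅ e ⁆ g∈S) g<f
    ... | inj₂ refl = ∈-below⁺ (x∈p∪⁅x⁆ S e) e<f

  below-mono : ∀ S {e f} → toℕ e < toℕ f → below S e ⊆ below S f
  below-mono S e<f g∈ = let g∈S , g<e = ∈-below⁻ g∈ in ∈-below⁺ g∈S (ℕₚ.<-trans g<e e<f)

  candidate-∪ : ∀ {S e f} → IsCandidate S e → toℕ e < toℕ f → IsCandidate (S ∪ ⁅ e ⁆) f ⇔ IsCandidate S f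
  candidate-∪ {S} {e} {f} cand e<f rewrite below-∪-smaller S e<f = ∈cl-absorb (∈cl-mono (below-mono S e<f) cand) f

  NoCandidateFrom : ℕ → Subset n → Set
  NoCandidateFrom m S = ∀ e → m ≤ toℕ e → ¬ IsCandidate S e

  noCandidateFrom? : ∀ m S → Dec (NoCandidateFrom m S)
  noCandidateFrom? m S = Finₚ.all? (λ e → (m ≤? toℕ e) →-dec ¬? (e ∈cl? below S e))

  noCandidateFrom-∪ : ∀ {S e m} → IsCandidate S e → toℕ e < m →
                      NoCandidateFrom m (S ∪ ⁅ e ⁆) ⇔ NoCandidateFrom m S
  noCandidateFrom-∪ cand e<m = mk⇔
    (λ none f m≤f → none f m≤f ∘ from (candidate-∪ cand (ℕₚ.<-≤-trans e<m m≤f)))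
    (λ none f m≤f → none f m≤f ∘ to (candidate-∪ cand (ℕₚ.<-≤-trans e<m m≤f)))

  noCandidateFrom-split : ∀ S e → NoCandidateFrom (toℕ e) S ⇔ (NoCandidateFrom (suc (toℕ e)) S × ¬ IsCandidate S e)
  noCandidateFrom-split S e = mk⇔
    (λ none → (λ f e<f → none f (ℕₚ.<⇒≤ e<f)) , none e ℕₚ.≤-refl)
    (λ (none , ¬cand) f e≤f → [ none f
                              , (λ e≡f → subst (λ g → ¬ IsCandidate S g) (Finₚ.toℕ-injective e≡f) ¬cand) ]′
                              (ℕₚ.m≤n⇒m<n∨m≡n e≤f))

  TopCandidate : Fin n → Subset n → Set
  TopCandidate e S = NoCandidateFrom (suc (toℕ e)) S × IsCandidate S e

  topCandidate? : ∀ e S → Dec (TopCandidate e S)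
  topCandidate? e S = noCandidateFrom? (suc (toℕ e)) S ×-dec e ∈cl? below S e

  topCandidate-∪ : ∀ e S → does (topCandidate? e (S ∪ ⁅ e ⁆)) ≡ does (topCandidate? e S)
  topCandidate-∪ e S = trans
    (cong (λ X → does (noCandidateFrom? (suc (toℕ e)) (S ∪ ⁅ e ⁆)) ∧ does (e ∈cl? X)) (below-∪-self S e))
    (∧-cong-if λ candᵇ → does-⇔ (noCandidateFrom-∪ (does-true⁻ (e ∈cl? below S e) candᵇ) (ℕₚ.n<1+n (toℕ e)))
                                (noCandidateFrom? (suc (toℕ e)) (S ∪ ⁅ e ⁆)) (noCandidateFrom? (suc (toℕ e)) S))

  module _ (φ : ℕ → ℤ) where

    signed : Subset n → ℤ
    signed S = φ (rank M S) * -1ℤ ℤ.^ (∣ S ∣ ∸ rank M S)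

    signed-∪ : ∀ {S e} → e ∉ S → e ∈cl S → signed (S ∪ ⁅ e ⁆) ≡ - signed S
    signed-∪ {S} {e} e∉S e∈clS rewrite e∈clS | x∉p⇒∣p∪⁅x⁆∣≡1+∣p∣ e∉S | ℕₚ.+-∸-assoc 1 (rank≤∣∣ S) =
      flip (φ (rank M S)) (-1ℤ ℤ.^ (∣ S ∣ ∸ rank M S))
      where
      flip : ∀ a b → a * (-1ℤ * b) ≡ - (a * b)
      flip = solve-∀

    ∑-signed-topCandidate : ∀ e → ∑[ S ] (signed S * 𝟙 (does (topCandidate? e S))) ≡ 0ℤ
    ∑-signed-topCandidate e = ∑-pairing e (λ S → signed S * 𝟙 (does (topCandidate? e S))) pair
      where
      pair : ∀ S → e ∉ S → signed S * 𝟙 (does (topCandidate? e S))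
                          + signed (S ∪ ⁅ e ⁆) * 𝟙 (does (topCandidate? e (S ∪ ⁅ e ⁆))) ≡ 0ℤ
      pair S e∉S rewrite topCandidate-∪ e S with does (topCandidate? e S) in top
      ... | false = cong₂ _+_ (ℤₚ.*-zeroʳ (signed S)) (ℤₚ.*-zeroʳ (signed (S ∪ ⁅ e ⁆)))
      ... | true  = begin
        signed S * 1ℤ + signed (S ∪ ⁅ e ⁆) * 1ℤ ≡⟨ cong (λ x → signed S * 1ℤ + x * 1ℤ) (signed-∪ e∉S e∈clS) ⟩
        signed S * 1ℤ + - signed S * 1ℤ         ≡⟨ cancel (signed S) ⟩
        0ℤ                                      ∎
        where
        open ≡-Reasoning
        e∈clS : e ∈cl S
        e∈clS = ∈cl-mono (p∩q⊆p S _) (proj₂ (does-true⁻ (topCandidate? e S) top))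
        cancel : ∀ a → a * 1ℤ + - a * 1ℤ ≡ 0ℤ
        cancel = solve-∀

    signedFrom : ℕ → Subset n → ℤ
    signedFrom m S = signed S * 𝟙 (does (noCandidateFrom? m S))

    ∑-signedFrom-step : ∀ e → ∑ (signedFrom (suc (toℕ e))) ≡ ∑ (signedFrom (toℕ e))
    ∑-signedFrom-step e = begin
      ∑ (signedFrom (suc (toℕ e)))
        ≡⟨ ∑-cong (λ S → cong (signed S *_) (𝟙-split (noCandidateFrom? (toℕ e) S) (noCandidateFrom? (suc (toℕ e)) S)
                                                      (e ∈cl? below S e) (noCandidateFrom-split S e))) ⟩
      ∑[ S ] (signed S * (𝟙 (does (noCandidateFrom? (toℕ e) S)) + 𝟙 (does (topCandidate? e S))))
        ≡⟨ ∑-cong (λ S → ℤₚ.*-distribˡ-+ (signed S) _ _) ⟩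
      ∑[ S ] (signedFrom (toℕ e) S + signed S * 𝟙 (does (topCandidate? e S)))
        ≡⟨ ∑-distrib-+ _ _ ⟩
      ∑ (signedFrom (toℕ e)) + ∑[ S ] (signed S * 𝟙 (does (topCandidate? e S)))
        ≡⟨ cong (λ x → ∑ (signedFrom (toℕ e)) + x) (∑-signed-topCandidate e) ⟩
      ∑ (signedFrom (toℕ e)) + 0ℤ
        ≡⟨ ℤₚ.+-identityʳ _ ⟩
      ∑ (signedFrom (toℕ e)) ∎
      where open ≡-Reasoning

    ∑-signedFrom : ∀ m → m ≤ n → ∑ (signedFrom m) ≡ ∑ (signedFrom 0)
    ∑-signedFrom zero    _     = refl
    ∑-signedFrom (suc m) 1+m≤n = trans
      (subst (λ k → ∑ (signedFrom (suc k)) ≡ ∑ (signedFrom k)) (Finₚ.toℕ-fromℕ< 1+m≤n)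
             (∑-signedFrom-step (Fin.fromℕ< 1+m≤n)))
      (∑-signedFrom m (ℕₚ.<⇒≤ 1+m≤n))

  noCandidateFrom-n : ∀ S → does (noCandidateFrom? n S) ≡ true
  noCandidateFrom-n S = dec-true (noCandidateFrom? n S) (λ e n≤e → contradiction (Finₚ.toℕ<n e) (ℕₚ.≤⇒≯ n≤e))

  noCandidateFrom-0 : ∀ S → does (noCandidateFrom? 0 S) ≡ isNBC M S
  noCandidateFrom-0 S = does≡ (noCandidateFrom? 0 S) (λ none → ¬candidate⇒nbc (λ e → none e z≤n))
                                                       (λ nbc e _ → nbc⇒¬candidate nbc e)

  signed-indep : ∀ φ {S} → indep S ≡ true → signed φ S ≡ φ ∣ S ∣
  signed-indep φ {S} indS = begin
    φ (rank M S) * -1ℤ ℤ.^ (∣ S ∣ ∸ rank M S) ≡⟨ cong (λ k → φ k * -1ℤ ℤ.^ (∣ S ∣ ∸ k)) (rank-indep indS) ⟩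
    φ ∣ S ∣ * -1ℤ ℤ.^ (∣ S ∣ ∸ ∣ S ∣)         ≡⟨ cong (λ k → φ ∣ S ∣ * -1ℤ ℤ.^ k) (ℕₚ.n∸n≡0 ∣ S ∣) ⟩
    φ ∣ S ∣ * 1ℤ                              ≡⟨ ℤₚ.*-identityʳ (φ ∣ S ∣) ⟩
    φ ∣ S ∣                                   ∎
    where open ≡-Reasoning

  whitney : ∀ φ → ∑[ S ] signed φ S ≡ ∑[ S ] (𝟙 (isNBC M S) * φ ∣ S ∣)
  whitney φ = begin
    ∑[ S ] signed φ S                                    ≡⟨ ∑-cong (λ S → sym (ℤₚ.*-identityʳ (signed φ S))) ⟩
    ∑[ S ] (signed φ S * 1ℤ)                             ≡⟨ ∑-cong (λ S → cong (λ b → signed φ S * 𝟙 b) (noCandidateFrom-n S)) ⟨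
    ∑ (signedFrom φ n)                                   ≡⟨ ∑-signedFrom φ n ℕₚ.≤-refl ⟩
    ∑ (signedFrom φ 0)                                   ≡⟨ ∑-cong (λ S → cong (λ b → signed φ S * 𝟙 b) (noCandidateFrom-0 S)) ⟩
    ∑[ S ] (signed φ S * 𝟙 (isNBC M S))                  ≡⟨ ∑-cong (λ S → *𝟙≡𝟙* (isNBC M S) (signed-indep φ ∘ nbc⇒indep)) ⟩
    ∑[ S ] (𝟙 (isNBC M S) * φ ∣ S ∣)                     ∎
    where open ≡-Reasoning

module Activity {n : ℕ} (M : Matroid n) where
  open Matroid M
  open Rank M

  exchange-isBasis : ∀ {B x f} → isBasis M B ≡ true → x ∈ B → f ∉ B →
                     indep ((B - x) ∪ ⁅ f ⁆) ≡ true → isBasis M ((B - x) ∪ ⁅ f ⁆) ≡ true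
  exchange-isBasis isB x∈B f∉B indB′ = isBasis⁺ indB′ (trans (∣exchange∣ x∈B f∉B) (proj₂ (isBasis⁻ isB)))

  dualIndep⁻ : ∀ {X} → dualIndep M X ≡ true → ∃[ B ] (isBasis M B ≡ true × ∀ {y} → y ∈ X → y ∉ B)
  dualIndep⁻ h with anySubset-true⁻ h
  ... | B , hB with ∧-true⁻ hB
  ...   | isB , X∩B⊆ᵇ⊥ = B , isB , λ y∈X y∈B → ∉⊥ (⊆ᵇ⇒⊆ X∩B⊆ᵇ⊥ (x∈p∩q⁺ (y∈X , y∈B)))

  dualIndep⁺ : ∀ {X B} → isBasis M B ≡ true → (∀ {y} → y ∈ X → y ∉ B) → dualIndep M X ≡ true
  dualIndep⁺ {X} {B} isB disjoint = anySubset-true⁺ B (∧-true⁺ isB (⊆⇒⊆ᵇ λ y∈X∩B →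
    let y∈X , y∈B = x∈p∩q⁻ X B y∈X∩B in contradiction y∈B (disjoint y∈X)))

  Exchangeable : Subset n → Fin n → Fin n → Set
  Exchangeable B x y = y ∉ B × indep ((B - x) ∪ ⁅ y ⁆) ≡ true

  inCocircuit? : ∀ B x → Decidable (λ y → y ≡ x ⊎ Exchangeable B x y)
  inCocircuit? B x y = (y Fin.≟ x) ⊎-dec (¬? (y ∈? B) ×-dec (indep ((B - x) ∪ ⁅ y ⁆) Bool.≟ true))

  fundamentalCocircuit : Subset n → Fin n → Subset n
  fundamentalCocircuit B x = select (inCocircuit? B x)

  ∈-fundamentalCocircuit⁻ : ∀ {B x y} → y ∈ fundamentalCocircuit B x → y ≡ x ⊎ Exchangeable B x y
  ∈-fundamentalCocircuit⁻ {B} {x} = ∈-select⁻ (inCocircuit? B x)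

  ∈-fundamentalCocircuit⁺ : ∀ {B x y} → y ≡ x ⊎ Exchangeable B x y → y ∈ fundamentalCocircuit B x
  ∈-fundamentalCocircuit⁺ {B} {x} = ∈-select⁺ (inCocircuit? B x)

  cocircuit-meets-basis : ∀ {B B′ x} → isBasis M B ≡ true → x ∈ B → isBasis M B′ ≡ true →
                          ∃[ y ] (y ∈ fundamentalCocircuit B x × y ∈ B′)
  cocircuit-meets-basis {B} {B′} {x} isB x∈B isB′ with x ∈? B′
  ... | yes x∈B′ = x , ∈-fundamentalCocircuit⁺ (inj₁ refl) , x∈B′
  ... | no  x∉B′ with indep-augment (B - x) B′ (indep-⊆ (p─q⊆p B ⁅ x ⁆) (proj₁ (isBasis⁻ isB)))
                                    (proj₁ (isBasis⁻ isB′)) ∣B-x∣<∣B′∣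
    where
    ∣B-x∣<∣B′∣ : ∣ B - x ∣ < ∣ B′ ∣
    ∣B-x∣<∣B′∣ = subst (∣ B - x ∣ <_)
      (trans (x∈p⇒1+∣p-x∣≡∣p∣ x∈B) (trans (proj₂ (isBasis⁻ isB)) (sym (proj₂ (isBasis⁻ isB′)))))
      (ℕₚ.n<1+n _)
  ...   | y , y∈B′ , y∉B-x , indB-x∪y =
    y , ∈-fundamentalCocircuit⁺ (inj₂ ((λ y∈B → y∉B-x (x∈p∧x≢y⇒x∈p-y y∈B λ { refl → x∉B′ y∈B′ })) , indB-x∪y)) , y∈B′

  fundamentalCocircuit-isCircuit : ∀ {B x} → isBasis M B ≡ true → x ∈ B →
                                   IsCircuit (dualIndep M) (fundamentalCocircuit B x)
  fundamentalCocircuit-isCircuit {B} {x} isB x∈B = dependent , minimal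
    where
    dependent : dualIndep M (fundamentalCocircuit B x) ≡ false
    dependent = ¬-not λ dualIndepγ →
      let B′ , isB′ , disjoint = dualIndep⁻ dualIndepγ
          y , y∈γ , y∈B′ = cocircuit-meets-basis isB x∈B isB′
      in  disjoint y∈γ y∈B′

    minimal : ∀ {y} → y ∈ fundamentalCocircuit B x → dualIndep M (fundamentalCocircuit B x - y) ≡ true
    minimal {y} y∈γ with ∈-fundamentalCocircuit⁻ y∈γ
    ... | inj₁ refl = dualIndep⁺ isB λ z∈γ-x z∈B → case-z (x∈p-y⁻ z∈γ-x) z∈B
      where
      case-z : ∀ {z} → z ∈ fundamentalCocircuit B x × z ≢ x → z ∉ B
      case-z (z∈γ , z≢x) with ∈-fundamentalCocircuit⁻ z∈γ
      ... | inj₁ z≡x = contradiction z≡x z≢x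
      ... | inj₂ (z∉B , _) = z∉B
    ... | inj₂ (y∉B , indB′) = dualIndep⁺ (exchange-isBasis isB x∈B y∉B indB′) λ z∈γ-y z∈B′ → case-z (x∈p-y⁻ z∈γ-y) z∈B′
      where
      case-z : ∀ {z} → z ∈ fundamentalCocircuit B x × z ≢ y → z ∉ (B - x) ∪ ⁅ y ⁆
      case-z {z} (z∈γ , z≢y) z∈B′ with x∈p∪⁅y⁆⁻ (B - x) z∈B′
      ... | inj₂ z≡y = z≢y z≡y
      ... | inj₁ z∈B-x with x∈p-y⁻ z∈B-x | ∈-fundamentalCocircuit⁻ z∈γ
      ...   | _   , z≢x | inj₁ z≡x = z≢x z≡x
      ...   | z∈B , _   | inj₂ (z∉B , _) = z∉B z∈B

  -- Internal activity, defined through M⊥, says that x is the largest element of its fundamental cocircuit.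
  NoLargerExchange : Subset n → Fin n → Set
  NoLargerExchange B x = ∀ f → toℕ x < toℕ f → f ∉ B → indep ((B - x) ∪ ⁅ f ⁆) ≡ false

  intActive⇒noLargerExchange : ∀ {B x} → isBasis M B ≡ true → intActive M B x ≡ true → NoLargerExchange B x
  intActive⇒noLargerExchange {B} {x} isB active f x<f f∉B with ∧-true⁻ {x ∈ᵇ B} active
  ... | x∈ᵇB , external with extActive⁻ (dualIndep M) external
  ...   | _ , γ , (depγ , _) , γ⊆∁B∪x , (_ , max) = ¬-not λ indB′ →
    contradiction (trans (sym (dualIndep⁺ (exchange-isBasis isB (∈ᵇ⇒∈ x∈ᵇB) f∉B indB′) disjoint)) depγ) λ ()
    where
    disjoint : ∀ {y} → y ∈ γ → y ∉ (B - x) ∪ ⁅ f ⁆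
    disjoint {y} y∈γ y∈B′ with x∈p∪⁅y⁆⁻ (B - x) y∈B′
    ... | inj₂ refl = ℕₚ.<⇒≱ x<f (max y∈γ)
    ... | inj₁ y∈B-x with x∈p-y⁻ y∈B-x | x∈p∪⁅y⁆⁻ (∁ B) (γ⊆∁B∪x y∈γ)
    ...   | y∈B , _   | inj₁ y∈∁B = x∈∁p⇒x∉p y∈∁B y∈B
    ...   | _   , y≢x | inj₂ y≡x  = y≢x y≡x

  noLargerExchange⇒intActive : ∀ {B x} → isBasis M B ≡ true → x ∈ B → NoLargerExchange B x →
                               intActive M B x ≡ true
  noLargerExchange⇒intActive {B} {x} isB x∈B noExchange =
    ∧-true⁺ (∈⇒∈ᵇ x∈B) (extActive⁺ (dualIndep M) (x∈p⇒x∉∁p x∈B) (fundamentalCocircuit-isCircuit isB x∈B)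
                                   γ⊆∁B∪x (∈-fundamentalCocircuit⁺ (inj₁ refl) , max))
    where
    γ⊆∁B∪x : fundamentalCocircuit B x ⊆ ∁ B ∪ ⁅ x ⁆
    γ⊆∁B∪x y∈γ with ∈-fundamentalCocircuit⁻ y∈γ
    ... | inj₁ refl = x∈p∪⁅x⁆ (∁ B) x
    ... | inj₂ (y∉B , _) = p⊆p∪q ⁅ x ⁆ (x∉p⇒x∈∁p y∉B)
    max : ∀ {y} → y ∈ fundamentalCocircuit B x → toℕ y ≤ toℕ x
    max y∈γ with ∈-fundamentalCocircuit⁻ y∈γ
    ... | inj₁ refl = ℕₚ.≤-refl
    ... | inj₂ (y∉B , indB′) = ℕₚ.≮⇒≥ λ x<y → contradiction (trans (sym indB′) (noExchange _ x<y y∉B)) λ ()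

module Faces {n : ℕ} (M : Matroid n) where
  open Matroid M
  open Rank M
  open BrokenCircuits M
  open Activity M

  atLeast : ℕ → Subset n
  atLeast m = select (λ f → m ≤? toℕ f)

  ∈-atLeast⁻ : ∀ {m f} → f ∈ atLeast m → m ≤ toℕ f
  ∈-atLeast⁻ {m} = ∈-select⁻ (λ f → m ≤? toℕ f)

  ∈-atLeast⁺ : ∀ {m f} → m ≤ toℕ f → f ∈ atLeast m
  ∈-atLeast⁺ {m} = ∈-select⁺ (λ f → m ≤? toℕ f)

  Z∪above : Subset n → Fin n → Subset n
  Z∪above Z x = Z ∪ atLeast (suc (toℕ x))

  -- For independent Z this is B_Z ∖ Z in the paper's notation.
  greedy : Subset n → Subset n
  greedy Z = select (λ x → ¬? (x ∈cl? Z∪above Z x))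

  ∈-greedy⁻ : ∀ {Z x} → x ∈ greedy Z → ¬ x ∈cl Z∪above Z x
  ∈-greedy⁻ {Z} = ∈-select⁻ (λ x → ¬? (x ∈cl? Z∪above Z x))

  ∈-greedy⁺ : ∀ {Z x} → ¬ x ∈cl Z∪above Z x → x ∈ greedy Z
  ∈-greedy⁺ {Z} = ∈-select⁺ (λ x → ¬? (x ∈cl? Z∪above Z x))

  greedy-disjoint : ∀ {Z x} → x ∈ greedy Z → x ∉ Z
  greedy-disjoint {Z} {x} x∈greedy x∈Z = ∈-greedy⁻ x∈greedy (∈⇒∈cl (p⊆p∪q _ x∈Z))

  greedy-antitone : ∀ {Z Z′} → Z ⊆ Z′ → greedy Z′ ⊆ greedy Z
  greedy-antitone Z⊆Z′ x∈greedy = ∈-greedy⁺ λ x∈cl → ∈-greedy⁻ x∈greedy (∈cl-mono (∪-monoˡ _ Z⊆Z′) x∈cl)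

  isBasisOf⁻ : ∀ {Z B} → isBasisOf M Z B ≡ true →
               isBasis M B ≡ true × Z ⊆ B × (∀ {e} → e ∈ B ─ Z → intActive M B e ≡ true)
  isBasisOf⁻ {Z} {B} h with ∧-true⁻ h
  ... | isB , rest with ∧-true⁻ rest
  ...   | Z⊆ᵇB , active = isB , ⊆ᵇ⇒⊆ Z⊆ᵇB ,
    λ {e} e∈ → allElem-⇒ᵇ⁻ (_∈ᵇ (B ─ Z)) (intActive M B) active e (∈⇒∈ᵇ e∈)

  isBasisOf⁺ : ∀ {Z B} → isBasis M B ≡ true → Z ⊆ B → (∀ {e} → e ∈ B ─ Z → intActive M B e ≡ true) →
               isBasisOf M Z B ≡ true
  isBasisOf⁺ {Z} {B} isB Z⊆B active =
    ∧-true⁺ isB (∧-true⁺ (⊆⇒⊆ᵇ Z⊆B) (allElem-⇒ᵇ⁺ (_∈ᵇ (B ─ Z)) (intActive M B) (λ e → active ∘ ∈ᵇ⇒∈)))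

  -- If x were spanned by Z and the larger elements, then B - x could be augmented inside
  -- (B - x) ∪ atLeast (1 + x) by some y > x, so x would not be internally active in B.
  isBasisOf⇒⊆greedy : ∀ {Z B} → isBasisOf M Z B ≡ true → B ─ Z ⊆ greedy Z
  isBasisOf⇒⊆greedy {Z} {B} basisOf {x} x∈B─Z with isBasisOf⁻ basisOf | x∈p─q⁻ B Z x∈B─Z
  ... | isB , Z⊆B , active | x∈B , x∉Z = ∈-greedy⁺ λ x∈cl →
    let indB = proj₁ (isBasis⁻ isB)
        x∈clV = ∈cl-mono (∪-monoˡ _ Z⊆B-x) x∈cl
        ∣B-x∣<rankV = begin-strict
          ∣ B - x ∣            <⟨ ℕₚ.n<1+n _ ⟩
          suc ∣ B - x ∣        ≡⟨ x∈p⇒1+∣p-x∣≡∣p∣ x∈B ⟩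
          ∣ B ∣                ≤⟨ indep⇒∣∣≤rank indB (⊆-trans (p⊆p-x∪⁅x⁆ B x) (∪-monoˡ ⁅ x ⁆ (p⊆p∪q _))) ⟩
          rank M (V ∪ ⁅ x ⁆)   ≡⟨ x∈clV ⟩
          rank M V             ∎
        y , y∈V , y∉B-x , indB′ = augment (indep-⊆ (p─q⊆p B ⁅ x ⁆) indB) (p⊆p∪q _) ∣B-x∣<rankV
        x<y = ∈-atLeast⁻ (above y∈V y∉B-x)
        y∉B = λ y∈B → y∉B-x (x∈p∧x≢y⇒x∈p-y y∈B λ y≡x → ℕₚ.<-irrefl (cong toℕ (sym y≡x)) x<y)
    in contradiction (trans (sym indB′) (intActive⇒noLargerExchange isB (active x∈B─Z) y x<y y∉B)) λ ()
    where
    open ℕₚ.≤-Reasoning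
    V = (B - x) ∪ atLeast (suc (toℕ x))
    Z⊆B-x : Z ⊆ B - x
    Z⊆B-x z∈Z = x∈p∧x≢y⇒x∈p-y (Z⊆B z∈Z) λ { refl → x∉Z z∈Z }
    above : ∀ {y} → y ∈ V → y ∉ B - x → y ∈ atLeast (suc (toℕ x))
    above y∈V y∉B-x with x∈p∪q⁻ (B - x) _ y∈V
    ... | inj₁ y∈B-x = contradiction y∈B-x y∉B-x
    ... | inj₂ y∈above = y∈above

  atLeast-toℕ : ∀ x → atLeast (toℕ x) ≡ atLeast (suc (toℕ x)) ∪ ⁅ x ⁆
  atLeast-toℕ x = ⊆-antisym ⊆∪ (∪-⊆ (∈-atLeast⁺ ∘ ℕₚ.<⇒≤ ∘ ∈-atLeast⁻) (⁅⁆-⊆ (∈-atLeast⁺ ℕₚ.≤-refl)))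
    where
    ⊆∪ : atLeast (toℕ x) ⊆ atLeast (suc (toℕ x)) ∪ ⁅ x ⁆
    ⊆∪ {y} y∈ with toℕ x ℕ.≟ toℕ y
    ... | yes x≡y rewrite Finₚ.toℕ-injective x≡y = x∈p∪⁅x⁆ _ y
    ... | no  x≢y = p⊆p∪q ⁅ x ⁆ (∈-atLeast⁺ (ℕₚ.≤∧≢⇒< (∈-atLeast⁻ y∈) x≢y))

  ∉atLeast-n : ∀ {y} → y ∉ atLeast n
  ∉atLeast-n {y} y∈ = ℕₚ.<⇒≱ (Finₚ.toℕ<n y) (∈-atLeast⁻ y∈)

  ∩⁅⁆-∈ : ∀ {p : Subset n} {x} → x ∈ p → p ∩ ⁅ x ⁆ ≡ ⁅ x ⁆
  ∩⁅⁆-∈ {p} {x} x∈p = ⊆-antisym (p∩q⊆q p ⁅ x ⁆) λ y∈⁅x⁆ →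
    x∈p∩q⁺ (subst (_∈ p) (sym (x∈⁅y⁆⇒x≡y x y∈⁅x⁆)) x∈p , y∈⁅x⁆)

  ∩⁅⁆-∉ : ∀ {p : Subset n} {x} → x ∉ p → p ∩ ⁅ x ⁆ ≡ ⊥
  ∩⁅⁆-∉ {p} {x} x∉p = ⊆-antisym (λ y∈ → let y∈p , y∈⁅x⁆ = x∈p∩q⁻ p ⁅ x ⁆ y∈ in
    contradiction (subst (_∈ p) (x∈⁅y⁆⇒x≡y x y∈⁅x⁆) y∈p) x∉p) ⊥⊆

  greedyFrom : Subset n → ℕ → Subset n
  greedyFrom Z m = Z ∪ (greedy Z ∩ atLeast m)

  greedyFrom-toℕ : ∀ Z x → greedyFrom Z (toℕ x) ≡ greedyFrom Z (suc (toℕ x)) ∪ (greedy Z ∩ ⁅ x ⁆)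
  greedyFrom-toℕ Z x = begin
    Z ∪ (greedy Z ∩ atLeast (toℕ x))                             ≡⟨ cong (λ A → Z ∪ (greedy Z ∩ A)) (atLeast-toℕ x) ⟩
    Z ∪ (greedy Z ∩ (atLeast (suc (toℕ x)) ∪ ⁅ x ⁆))              ≡⟨ cong (Z ∪_) (∩-distribˡ-∪ (greedy Z) _ ⁅ x ⁆) ⟩
    Z ∪ ((greedy Z ∩ atLeast (suc (toℕ x))) ∪ (greedy Z ∩ ⁅ x ⁆)) ≡⟨ ∪-assoc Z _ _ ⟨
    greedyFrom Z (suc (toℕ x)) ∪ (greedy Z ∩ ⁅ x ⁆)               ∎
    where open ≡-Reasoning

  Z∪atLeast-toℕ : ∀ Z x → Z ∪ atLeast (toℕ x) ≡ Z∪above Z x ∪ ⁅ x ⁆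
  Z∪atLeast-toℕ Z x = trans (cong (Z ∪_) (atLeast-toℕ x)) (sym (∪-assoc Z _ ⁅ x ⁆))

  greedyFrom⊆Z∪above : ∀ Z x → greedyFrom Z (suc (toℕ x)) ⊆ Z∪above Z x
  greedyFrom⊆Z∪above Z x = ∪-monoʳ Z (p∩q⊆q (greedy Z) _)

  -- greedy Z arises by scanning downwards and keeping each element not spanned by what is above it;
  -- the partial results stay independent and span as much as Z together with the scanned elements.
  GreedyInvariant : Subset n → ℕ → Set
  GreedyInvariant Z m = indep (greedyFrom Z m) ≡ true × rank M (greedyFrom Z m) ≡ rank M (Z ∪ atLeast m)

  greedyInvariant-n : ∀ {Z} → indep Z ≡ true → GreedyInvariant Z n
  greedyInvariant-n {Z} indZ =
    subst (λ P → indep P ≡ true) (sym P≡Z) indZ , cong (rank M) (trans P≡Z (sym Z∪atLeast-n≡Z))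
    where
    P≡Z : greedyFrom Z n ≡ Z
    P≡Z = ⊆-antisym (∪-⊆ ⊆-refl (λ y∈ → contradiction (p∩q⊆q (greedy Z) _ y∈) ∉atLeast-n)) (p⊆p∪q _)
    Z∪atLeast-n≡Z : Z ∪ atLeast n ≡ Z
    Z∪atLeast-n≡Z = ⊆-antisym (∪-⊆ ⊆-refl (λ y∈ → contradiction y∈ ∉atLeast-n)) (p⊆p∪q _)

  greedyInvariant-step : ∀ {Z} x → GreedyInvariant Z (suc (toℕ x)) → GreedyInvariant Z (toℕ x)
  greedyInvariant-step {Z} x (indP′ , rankP′) with x ∈? greedy Z
  ... | no x∉G = subst (λ P → indep P ≡ true) (sym P≡P′) indP′ , (begin
    rank M (greedyFrom Z (toℕ x)) ≡⟨ cong (rank M) P≡P′ ⟩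
    rank M P′                      ≡⟨ rankP′ ⟩
    rank M W                       ≡⟨ decidable-stable (x ∈cl? W) (x∉G ∘ ∈-greedy⁺) ⟨
    rank M (W ∪ ⁅ x ⁆)             ≡⟨ cong (rank M) (Z∪atLeast-toℕ Z x) ⟨
    rank M (Z ∪ atLeast (toℕ x))   ∎)
    where
    open ≡-Reasoning
    P′ = greedyFrom Z (suc (toℕ x))
    W = Z∪above Z x
    P≡P′ : greedyFrom Z (toℕ x) ≡ P′
    P≡P′ = trans (greedyFrom-toℕ Z x) (trans (cong (P′ ∪_) (∩⁅⁆-∉ x∉G)) (∪-identityʳ P′))
  ... | yes x∈G = subst (λ P → indep P ≡ true) (sym P≡P′∪x) indP′∪x , (begin
    rank M (greedyFrom Z (toℕ x)) ≡⟨ cong (rank M) P≡P′∪x ⟩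
    rank M (P′ ∪ ⁅ x ⁆)            ≡⟨ ∉cl⇒rank-suc x∉clP′ ⟩
    suc (rank M P′)                ≡⟨ cong suc rankP′ ⟩
    suc (rank M W)                 ≡⟨ ∉cl⇒rank-suc (∈-greedy⁻ x∈G) ⟨
    rank M (W ∪ ⁅ x ⁆)             ≡⟨ cong (rank M) (Z∪atLeast-toℕ Z x) ⟨
    rank M (Z ∪ atLeast (toℕ x))   ∎)
    where
    open ≡-Reasoning
    P′ = greedyFrom Z (suc (toℕ x))
    W = Z∪above Z x
    P≡P′∪x : greedyFrom Z (toℕ x) ≡ P′ ∪ ⁅ x ⁆
    P≡P′∪x = trans (greedyFrom-toℕ Z x) (cong (P′ ∪_) (∩⁅⁆-∈ x∈G))
    x∉clP′ : ¬ x ∈cl P′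
    x∉clP′ = ∈-greedy⁻ x∈G ∘ ∈cl-mono (greedyFrom⊆Z∪above Z x)
    indP′∪x : indep (P′ ∪ ⁅ x ⁆) ≡ true
    indP′∪x = ∣∣≤rank⇒indep (ℕₚ.≤-reflexive (begin
      ∣ P′ ∪ ⁅ x ⁆ ∣     ≡⟨ x∉p⇒∣p∪⁅x⁆∣≡1+∣p∣ (x∉clP′ ∘ ∈⇒∈cl) ⟩
      suc ∣ P′ ∣         ≡⟨ cong suc (rank-indep indP′) ⟨
      suc (rank M P′)    ≡⟨ ∉cl⇒rank-suc x∉clP′ ⟨
      rank M (P′ ∪ ⁅ x ⁆) ∎))

  greedyInvariant : ∀ {Z} → indep Z ≡ true → ∀ m → m ≤ n → GreedyInvariant Z m
  greedyInvariant {Z} indZ m m≤n = go (n ∸ m) m (ℕₚ.m∸n+n≡m m≤n)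
    where
    go : ∀ k m → k ℕ.+ m ≡ n → GreedyInvariant Z m
    go zero    m refl = greedyInvariant-n indZ
    go (suc k) m 1+k+m≡n = subst (GreedyInvariant Z) (Finₚ.toℕ-fromℕ< m<n)
      (greedyInvariant-step (Fin.fromℕ< m<n)
        (subst (λ j → GreedyInvariant Z (suc j)) (sym (Finₚ.toℕ-fromℕ< m<n))
          (go k (suc m) (trans (ℕₚ.+-suc k m) 1+k+m≡n))))
      where
      m<n : m < n
      m<n = subst (suc m ≤_) 1+k+m≡n (s≤s (ℕₚ.m≤n+m m k))

  greedyBasis : Subset n → Subset n
  greedyBasis Z = Z ∪ greedy Z

  greedyFrom-0 : ∀ Z → greedyFrom Z 0 ≡ greedyBasis Z
  greedyFrom-0 Z = cong (Z ∪_) (⊆-antisym (p∩q⊆p (greedy Z) _) (λ y∈ → x∈p∩q⁺ (y∈ , ∈-atLeast⁺ z≤n)))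

  greedyBasis-isBasis : ∀ {Z} → indep Z ≡ true → isBasis M (greedyBasis Z) ≡ true
  greedyBasis-isBasis {Z} indZ with greedyInvariant indZ 0 z≤n
  ... | indP , rankP rewrite greedyFrom-0 Z = isBasis⁺ indP (begin
    ∣ greedyBasis Z ∣          ≡⟨ rank-indep indP ⟨
    rank M (greedyBasis Z)     ≡⟨ rankP ⟩
    rank M (Z ∪ atLeast 0)     ≡⟨ cong (rank M) (⊆-antisym ⊆⊤ (λ y∈ → q⊆p∪q Z _ (∈-atLeast⁺ z≤n))) ⟩
    r                          ∎)
    where open ≡-Reasoning

  greedy-noLargerExchange : ∀ {Z e} → indep Z ≡ true → e ∈ greedy Z → NoLargerExchange (greedyBasis Z) e
  greedy-noLargerExchange {Z} {e} indZ e∈G f e<f f∉B =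
    maxIndep-∈cl⁻ (indB-e , ⊆-refl , sym (rank-indep indB-e)) f∈clB-e (f∉B ∘ proj₁ ∘ x∈p-y⁻)
    where
    B = greedyBasis Z
    P′ = greedyFrom Z (suc (toℕ e))
    indB-e : indep (B - e) ≡ true
    indB-e = indep-⊆ (p─q⊆p B ⁅ e ⁆) (proj₁ (isBasis⁻ (greedyBasis-isBasis indZ)))
    f∈clP′ : f ∈cl P′
    f∈clP′ = ℕₚ.≤-antisym
      (ℕₚ.≤-trans (rank-mono (∪-⊆ (greedyFrom⊆Z∪above Z e) (⁅⁆-⊆ (q⊆p∪q Z _ (∈-atLeast⁺ e<f)))))
                  (ℕₚ.≤-reflexive (sym (proj₂ (greedyInvariant indZ (suc (toℕ e)) (Finₚ.toℕ<n e))))))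
      (rank-mono (p⊆p∪q ⁅ f ⁆))
    P′⊆B-e : P′ ⊆ B - e
    P′⊆B-e y∈P′ with x∈p∪q⁻ Z _ y∈P′
    ... | inj₁ y∈Z = x∈p∧x≢y⇒x∈p-y (p⊆p∪q _ y∈Z) λ { refl → greedy-disjoint e∈G y∈Z }
    ... | inj₂ y∈G≥ = let y∈G , e<y = x∈p∩q⁻ (greedy Z) _ y∈G≥ in
      x∈p∧x≢y⇒x∈p-y (q⊆p∪q Z _ y∈G) λ { refl → ℕₚ.<-irrefl refl (∈-atLeast⁻ e<y) }
    f∈clB-e : f ∈cl (B - e)
    f∈clB-e = ∈cl-mono P′⊆B-e f∈clP′

  greedyBasis-isBasisOf : ∀ {Z} → indep Z ≡ true → isBasisOf M Z (greedyBasis Z) ≡ true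
  greedyBasis-isBasisOf {Z} indZ = isBasisOf⁺ isB (p⊆p∪q _) λ e∈B─Z →
    let e∈B , e∉Z = x∈p─q⁻ (greedyBasis Z) Z e∈B─Z
        e∈G = [ (λ e∈Z → contradiction e∈Z e∉Z) , id ]′ (x∈p∪q⁻ Z _ e∈B)
    in noLargerExchange⇒intActive isB e∈B (greedy-noLargerExchange indZ e∈G)
    where
    isB = greedyBasis-isBasis indZ

  ∣Z∣+∣greedy∣≡r : ∀ {Z} → indep Z ≡ true → ∣ Z ∣ ℕ.+ ∣ greedy Z ∣ ≡ r
  ∣Z∣+∣greedy∣≡r {Z} indZ = trans (sym (disjoint⇒∣p∪q∣≡∣p∣+∣q∣ Z (greedy Z) λ x∈Z x∈G → greedy-disjoint x∈G x∈Z))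
                                  (proj₂ (isBasis⁻ (greedyBasis-isBasis indZ)))

  isFacetΔ⁻ : ∀ {A Z} → isFacetΔ M A Z ≡ true →
              isNBC M Z ≡ true × ∃[ B ] (isBasisOf M Z B ≡ true × A ⊆ B ─ Z)
  isFacetΔ⁻ {A} {Z} facet with ∧-true⁻ {isNBC M Z} facet
  ... | nbcZ , ∃B with anySubset-true⁻ {p = λ B → isBasisOf M Z B ∧ (A ⊆ᵇ (B ─ Z)) ∧ ((B ─ Z) ⊆ᵇ A)} ∃B
  ...   | B , hB with ∧-true⁻ {isBasisOf M Z B} hB
  ...     | basisOf , A⊆B─Z∧B─Z⊆A =
    nbcZ , B , basisOf , ⊆ᵇ⇒⊆ {p = A} (proj₁ (∧-true⁻ {A ⊆ᵇ (B ─ Z)} A⊆B─Z∧B─Z⊆A))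

  isFaceΔ⁻ : ∀ {A Z} → isFaceΔ M A Z ≡ true →
             ∃[ A′ ] ∃[ Z′ ] (isFacetΔ M A′ Z′ ≡ true × A ⊆ A′ × Z ⊆ Z′)
  isFaceΔ⁻ {A} {Z} face
    with anySubset-true⁻ {p = λ A′ → anySubset (λ Z′ → isFacetΔ M A′ Z′ ∧ (A ⊆ᵇ A′) ∧ (Z ⊆ᵇ Z′))} face
  ... | A′ , face′ with anySubset-true⁻ {p = λ Z′ → isFacetΔ M A′ Z′ ∧ (A ⊆ᵇ A′) ∧ (Z ⊆ᵇ Z′)} face′
  ...   | Z′ , h with ∧-true⁻ {isFacetΔ M A′ Z′} h
  ...     | facet , h′ with ∧-true⁻ {A ⊆ᵇ A′} h′
  ...       | A⊆A′ , Z⊆Z′ = A′ , Z′ , facet , ⊆ᵇ⇒⊆ {p = A} A⊆A′ , ⊆ᵇ⇒⊆ {p = Z} Z⊆Z′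

  isFacetΔ⇒⊆greedy : ∀ {A Z} → isFacetΔ M A Z ≡ true → A ⊆ greedy Z
  isFacetΔ⇒⊆greedy {A} {Z} facet with isFacetΔ⁻ {A} {Z} facet
  ... | _ , B , basisOf , A⊆B─Z = λ a∈A → isBasisOf⇒⊆greedy {Z} {B} basisOf (A⊆B─Z a∈A)

  isFaceΔ⇒ : ∀ {A Z} → isFaceΔ M A Z ≡ true → isNBC M Z ≡ true × A ⊆ greedy Z
  isFaceΔ⇒ {A} {Z} face =
    let A′ , Z′ , facet , A⊆A′ , Z⊆Z′ = isFaceΔ⁻ {A} {Z} face
    in  nbc-⊆ {Z} {Z′} Z⊆Z′ (proj₁ (isFacetΔ⁻ {A′} {Z′} facet)) ,
        λ a∈A → greedy-antitone {Z} {Z′} Z⊆Z′ (isFacetΔ⇒⊆greedy {A′} {Z′} facet (A⊆A′ a∈A))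

  isFaceΔ⇐ : ∀ {A Z} → isNBC M Z ≡ true → A ⊆ greedy Z → isFaceΔ M A Z ≡ true
  isFaceΔ⇐ {A} {Z} nbcZ A⊆G =
    anySubset-true⁺ (B ─ Z) (anySubset-true⁺ Z
      (∧-true⁺ facet (∧-true⁺ (⊆⇒⊆ᵇ A⊆B─Z) (⊆⇒⊆ᵇ {p = Z} ⊆-refl))))
    where
    B = greedyBasis Z
    facet : isFacetΔ M (B ─ Z) Z ≡ true
    facet = ∧-true⁺ nbcZ (anySubset-true⁺ B (∧-true⁺ (greedyBasis-isBasisOf (nbc⇒indep nbcZ))
      (∧-true⁺ (⊆⇒⊆ᵇ {p = B ─ Z} ⊆-refl) (⊆⇒⊆ᵇ {p = B ─ Z} ⊆-refl))))
    A⊆B─Z : A ⊆ B ─ Z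
    A⊆B─Z a∈A = x∈p∧x∉q⇒x∈p─q (q⊆p∪q Z _ (A⊆G a∈A)) (greedy-disjoint (A⊆G a∈A))

  isFaceΔ≡ : ∀ A Z → isFaceΔ M A Z ≡ isNBC M Z ∧ does (A ⊆? greedy Z)
  isFaceΔ≡ A Z = ⇔→≡ (mk⇔
    (λ face → let nbcZ , A⊆G = isFaceΔ⇒ face in ∧-true⁺ nbcZ (dec-true (A ⊆? greedy Z) A⊆G))
    (λ h → let nbcZ , A⊆Gᵇ = ∧-true⁻ {isNBC M Z} h in isFaceΔ⇐ nbcZ (does-true⁻ (A ⊆? greedy Z) A⊆Gᵇ)))

module Counting {n : ℕ} (M : Matroid n) where
  open Rank M
  open BrokenCircuits M
  open Whitney M
  open Faces M

  coeff-tutte : ∀ k → coeff (tutte M (oneₚ +ₚ Xₚ) (constₚ (+ 0))) k ≡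
                      ∑[ Z ] (𝟙 (isNBC M Z) * δ (r ∸ ∣ Z ∣) k)
  coeff-tutte k =
    trans (coeff-foldr-+ₚ _ (allSubsets n) k)
    (trans (sumList-allSubsets _)
    (trans (∑-cong λ S → coeff-Xₚ^ₚ-*ₚ-constₚ^ₚ (r ∸ rank M S) -1ℤ (∣ S ∣ ∸ rank M S) k)
           (whitney (λ j → δ (r ∸ j) k))))

  +fΔ≡∑ : ∀ i → + fΔ M i ≡ ∑[ A ] ∑[ Z ] (𝟙 (isFaceΔ M A Z) * δ (∣ A ∣ ℕ.+ ∣ Z ∣) i)
  +fΔ≡∑ i =
    trans (+-sum-map _ (allSubsets n))
    (trans (sumList-allSubsets _)
    (∑-cong λ A → trans (countSubsets≡∑ _) (∑-cong λ Z →
      trans (𝟙-∧ (isFaceΔ M A Z) _) (cong (λ b → 𝟙 (isFaceΔ M A Z) * 𝟙 b) (isYes≗does (∣ A ∣ ℕ.+ ∣ Z ∣ ℕ.≟ i))))))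

  face-size : ∀ {A Z} → isFaceΔ M A Z ≡ true → ∣ A ∣ ℕ.+ ∣ Z ∣ ≤ r
  face-size {A} {Z} face = let nbcZ , A⊆G = isFaceΔ⇒ {A} {Z} face in begin
    ∣ A ∣ ℕ.+ ∣ Z ∣          ≤⟨ ℕₚ.+-monoˡ-≤ ∣ Z ∣ (p⊆q⇒∣p∣≤∣q∣ A⊆G) ⟩
    ∣ greedy Z ∣ ℕ.+ ∣ Z ∣   ≡⟨ ℕₚ.+-comm ∣ greedy Z ∣ ∣ Z ∣ ⟩
    ∣ Z ∣ ℕ.+ ∣ greedy Z ∣   ≡⟨ ∣Z∣+∣greedy∣≡r (nbc⇒indep nbcZ) ⟩
    r                        ∎
    where open ℕₚ.≤-Reasoning

  faceWeight : ℕ → Subset n → Subset n → ℤ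
  faceWeight k A Z = 𝟙 (isFaceΔ M A Z) * coeff ([X-1]^ (r ∸ (∣ A ∣ ℕ.+ ∣ Z ∣))) k

  ∑≤-faceWeight : ∀ k A Z → ∑≤ r (λ i → 𝟙 (isFaceΔ M A Z) * δ (∣ A ∣ ℕ.+ ∣ Z ∣) i * coeff ([X-1]^ (r ∸ i)) k)
                            ≡ faceWeight k A Z
  ∑≤-faceWeight k A Z =
    trans (∑≤-cong r (λ i → ℤₚ.*-assoc (𝟙 (isFaceΔ M A Z)) _ _))
    (trans (∑≤-*ˡ r (𝟙 (isFaceΔ M A Z)) _)
           (𝟙*-cong (isFaceΔ M A Z) λ face →
             ∑≤-δ r (∣ A ∣ ℕ.+ ∣ Z ∣) (λ i → coeff ([X-1]^ (r ∸ i)) k) (face-size {A} {Z} face)))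

  ∑-faceWeight : ∀ k Z → ∑[ A ] faceWeight k A Z ≡ 𝟙 (isNBC M Z) * δ (r ∸ ∣ Z ∣) k
  ∑-faceWeight k Z = begin
    ∑[ A ] faceWeight k A Z
      ≡⟨ ∑-cong (λ A → cong (_* c A) (trans (cong 𝟙 (isFaceΔ≡ A Z)) (𝟙-∧ (isNBC M Z) _))) ⟩
    ∑[ A ] (𝟙 (isNBC M Z) * 𝟙 (does (A ⊆? greedy Z)) * c A)
      ≡⟨ ∑-cong (λ A → ℤₚ.*-assoc (𝟙 (isNBC M Z)) _ _) ⟩
    ∑[ A ] (𝟙 (isNBC M Z) * (𝟙 (does (A ⊆? greedy Z)) * c A))
      ≡⟨ ∑-*ˡ (𝟙 (isNBC M Z)) _ ⟩
    𝟙 (isNBC M Z) * ∑[ A ] (𝟙 (does (A ⊆? greedy Z)) * c A)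
      ≡⟨ 𝟙*-cong (isNBC M Z) binomial ⟩
    𝟙 (isNBC M Z) * δ (r ∸ ∣ Z ∣) k ∎
    where
    open ≡-Reasoning
    c : Subset n → ℤ
    c A = coeff ([X-1]^ (r ∸ (∣ A ∣ ℕ.+ ∣ Z ∣))) k
    binomial : isNBC M Z ≡ true → ∑[ A ] (𝟙 (does (A ⊆? greedy Z)) * c A) ≡ δ (r ∸ ∣ Z ∣) k
    binomial nbcZ = begin
      ∑[ A ] (𝟙 (does (A ⊆? greedy Z)) * c A)
        ≡⟨ ∑-cong (λ A → cong (λ d → 𝟙 (does (A ⊆? greedy Z)) * coeff ([X-1]^ d) k) (exponent A)) ⟩
      ∑[ A ] (𝟙 (does (A ⊆? greedy Z)) * coeff ([X-1]^ (∣ greedy Z ∣ ∸ ∣ A ∣)) k)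
        ≡⟨ ∑-⊆-[X-1]^ (greedy Z) k ⟩
      δ (∣ greedy Z ∣) k
        ≡⟨ cong (λ d → δ d k) ∣greedy∣≡r∸∣Z∣ ⟩
      δ (r ∸ ∣ Z ∣) k ∎
      where
      r≡ : ∣ Z ∣ ℕ.+ ∣ greedy Z ∣ ≡ r
      r≡ = ∣Z∣+∣greedy∣≡r (nbc⇒indep nbcZ)
      ∣greedy∣≡r∸∣Z∣ : ∣ greedy Z ∣ ≡ r ∸ ∣ Z ∣
      ∣greedy∣≡r∸∣Z∣ = trans (sym (ℕₚ.m+n∸m≡n ∣ Z ∣ ∣ greedy Z ∣)) (cong (_∸ ∣ Z ∣) r≡)
      exponent : ∀ A → r ∸ (∣ A ∣ ℕ.+ ∣ Z ∣) ≡ ∣ greedy Z ∣ ∸ ∣ A ∣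
      exponent A = begin
        r ∸ (∣ A ∣ ℕ.+ ∣ Z ∣)                        ≡⟨ cong₂ _∸_ (sym r≡) (ℕₚ.+-comm (∣ A ∣) (∣ Z ∣)) ⟩
        (∣ Z ∣ ℕ.+ ∣ greedy Z ∣) ∸ (∣ Z ∣ ℕ.+ ∣ A ∣) ≡⟨ ℕₚ.[m+n]∸[m+o]≡n∸o (∣ Z ∣) (∣ greedy Z ∣) (∣ A ∣) ⟩
        ∣ greedy Z ∣ ∸ ∣ A ∣                          ∎

  coeff-hPolyΔ : ∀ k → coeff (hPolyΔ M) k ≡ ∑[ Z ] (𝟙 (isNBC M Z) * δ (r ∸ ∣ Z ∣) k)
  coeff-hPolyΔ k = begin
    coeff (hPolyΔ M) k
      ≡⟨ coeff-sumₚ r _ k ⟩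
    ∑≤ r (λ i → coeff ((+ fΔ M i) ·ₚ [X-1]^ (r ∸ i)) k)
      ≡⟨ ∑≤-cong r (λ i → trans (coeff-·ₚ (+ fΔ M i) ([X-1]^ (r ∸ i)) k)
                                (cong (_* coeff ([X-1]^ (r ∸ i)) k) (+fΔ≡∑ i))) ⟩
    ∑≤ r (λ i → ∑[ A ] ∑[ Z ] (𝟙 (isFaceΔ M A Z) * δ (∣ A ∣ ℕ.+ ∣ Z ∣) i) * coeff ([X-1]^ (r ∸ i)) k)
      ≡⟨ ∑≤-cong r (λ i → trans (sym (∑-*ʳ _ _)) (∑-cong (λ A → sym (∑-*ʳ _ _)))) ⟩
    ∑≤ r (λ i → ∑[ A ] ∑[ Z ] (𝟙 (isFaceΔ M A Z) * δ (∣ A ∣ ℕ.+ ∣ Z ∣) i * coeff ([X-1]^ (r ∸ i)) k))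
      ≡⟨ ∑≤-∑ r _ ⟩
    ∑[ A ] ∑≤ r (λ i → ∑[ Z ] (𝟙 (isFaceΔ M A Z) * δ (∣ A ∣ ℕ.+ ∣ Z ∣) i * coeff ([X-1]^ (r ∸ i)) k))
      ≡⟨ ∑-cong (λ A → trans (∑≤-∑ r _) (∑-cong (∑≤-faceWeight k A))) ⟩
    ∑[ A ] ∑[ Z ] faceWeight k A Z
      ≡⟨ ∑-comm (faceWeight k) ⟩
    ∑[ Z ] ∑[ A ] faceWeight k A Z
      ≡⟨ ∑-cong (∑-faceWeight k) ⟩
    ∑[ Z ] (𝟙 (isNBC M Z) * δ (r ∸ ∣ Z ∣) k) ∎
    where open ≡-Reasoning

  ∣nbc∣≤r : ∀ {Z} → isNBC M Z ≡ true → ∣ Z ∣ ≤ r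
  ∣nbc∣≤r nbcZ = indep⇒∣∣≤rank (nbc⇒indep nbcZ) ⊆⊤

  hΔ≡fNBC : ∀ i → i ≤ r → hΔ M i ≡ + fNBC M i
  hΔ≡fNBC i i≤r = begin
    coeff (hPolyΔ M) (r ∸ i)                        ≡⟨ coeff-hPolyΔ (r ∸ i) ⟩
    ∑[ Z ] (𝟙 (isNBC M Z) * δ (r ∸ ∣ Z ∣) (r ∸ i))  ≡⟨ ∑-cong (λ Z → 𝟙*-cong (isNBC M Z) (λ nbcZ → δ-∸ (∣nbc∣≤r nbcZ) i≤r)) ⟩
    ∑[ Z ] (𝟙 (isNBC M Z) * δ (∣ Z ∣) i)            ≡⟨ ∑-cong (λ Z → sym (𝟙-∧ (isNBC M Z) _)) ⟩
    ∑[ Z ] 𝟙 (isNBC M Z ∧ does (∣ Z ∣ ℕ.≟ i))       ≡⟨ ∑-cong (λ Z → cong (λ b → 𝟙 (isNBC M Z ∧ b)) (isYes≗does (∣ Z ∣ ℕ.≟ i))) ⟨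
    ∑[ Z ] 𝟙 (isNBC M Z ∧ ⌊ ∣ Z ∣ ℕ.≟ i ⌋)          ≡⟨ countSubsets≡∑ _ ⟨
    + fNBC M i                                      ∎
    where open ≡-Reasoning

corollary7p5 : ∀ {n : ℕ} (M : Matroid n) →
    (hPolyΔ M ≈ₚ tutte M (oneₚ +ₚ Xₚ) (constₚ (+ 0)))
    × (∀ i → i ≤ rk M → hΔ M i ≡ + fNBC M i)
corollary7p5 M = (λ k → trans (coeff-hPolyΔ k) (sym (coeff-tutte k))) , hΔ≡fNBC
  where open Counting M
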